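{- Let $T$ be a finite non-abelian simple group and $x,y\in T$ with $|x|=2$, $|y|$ an odd prime, and $T=\langle x,y\rangle$. Let $X=T\wr\mathrm{S}_6=T^6{:}\mathrm{S}_6$ with $(t_1,\dots,t_6)^\sigma=(t_{1^{\sigma^{ -1}}},\dots,t_{6^{\sigma^{ -1}}})$ for $\sigma\in\mathrm{S}_6$. Let $h_1=(146)(235)$, $h_2=(13)(24)(56)$, $\delta=(14)(23)(56)$ in $\mathrm{S}_6$, $H=\langle h_1,h_2\rangle$, $f=(y,y^{ -1},y,y^{ -1},x,x)\in T^6$, $g=f\delta$, $Y=\langle H,g\rangle$ and $\Gamma=\mathrm{Cos}(Y,H,HgH)$. Let $N=Y\cap T^6$, so that $Y/N\cong\mathrm{S}_4$. Then: (1) If $C\cong N.\mathbb{Z}_2^2$ denotes the full preimage in $Y$ of the normal subgroup $\mathbb{Z}_2^2$ of $\mathrm{S}_4\cong Y/N$, then $\Gamma\cong\mathrm{Cay}(C,S)$ where $S=\{s_1,s_2,s_3\}$ with $s_1=gh_2=(y,y^{ -1},y,y^{ -1},x,x)(12)(34)$, $s_2=h_2h_1gh_1=(x,x,y^{ -1},y,y,y^{ -1})(34)(56)$, $s_3=h_2h_1^{ -1}gh_1^{ -1}=(y^{ -1},y,x,x,y^{ -1},y)(12)(56)$. (2) $N=\langle t_1,t_2,t_3\rangle$, where $t_1=(yxy,\ y^{ -1}xy^{ -1},\ y^2x,\ y^{ -2}x,\ xy^2,\ xy^{ -2})$, $t_2=(y^2x,\ y^{ -2}x,\ yxy,\ y^{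 -1}xy^{ -1},\ xy^{ -2},\ xy^2)$, $t_3=(xy^2,\ xy^{ -2},\ y^{ -2}x,\ y^2x,\ yxy,\ y^{ -1}xy^{ -1})$.
   Context: Elements of $X$ are written as $(t_1,\dots,t_6)\sigma$ with $(t_i)\in T^6$, $\sigma\in\mathrm{S}_6$. For a group $G$, subgroup $H$ and $g\in G$, the coset graph $\mathrm{Cos}(G,H,HgH)$ has vertex set the right cosets $Hz$ ($z\in G$), with $(Hz,Hw)$ an arc iff $wz^{ -1}\in HgH$. For a group $C$ and an inverse-closed subset $S\subseteq C\setminus\{1\}$, the Cayley graph $\mathrm{Cay}(C,S)$ has vertex set $C$ with $a$ adjacent to $b$ iff $ba^{ -1}\in S$. Permutations act on the right. -}

module Defs where

open import Level using (Level; _⊔_) renaming (suc to lsuc)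
open import Algebra.Bundles using (Group)
open import Data.Fin using (Fin)
open import Data.Fin.Patterns
open import Data.Fin.Permutation as Perm
  using (Permutation′; _⟨$⟩ʳ_; _⟨$⟩ˡ_; _∘ₚ_; permutation)
open import Data.Nat as ℕ using (ℕ; zero; suc)
open import Data.List using (List)
open import Data.List.Relation.Unary.Any using (Any)
open import Data.Product using (Σ; ∃; ∃₂; _×_; _,_)
open import Data.Sum using (_⊎_)
open import Relation.Nullary using (¬_)
open import Relation.Binary.PropositionalEquality using (_≡_; refl)

data Generated {a ℓ s} {A : Set a} (_≈_ : A → A → Set ℓ) (_∙_ : A → A → A)
               (e : A) (inv : A → A) (S : A → Set s) : A → Set (a ⊔ ℓ ⊔ s) where
  gen  : ∀ {u} → S u → Generated _≈_ _∙_ e inv S u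
  one  : Generated _≈_ _∙_ e inv S e
  mul  : ∀ {u v} → Generated _≈_ _∙_ e inv S u → Generated _≈_ _∙_ e inv S v →
         Generated _≈_ _∙_ e inv S (u ∙ v)
  invc : ∀ {u} → Generated _≈_ _∙_ e inv S u → Generated _≈_ _∙_ e inv S (inv u)
  resp : ∀ {u v} → u ≈ v → Generated _≈_ _∙_ e inv S u → Generated _≈_ _∙_ e inv S v

record IsSubgroup {a ℓ p} {A : Set a} (_≈_ : A → A → Set ℓ) (_∙_ : A → A → A)
                  (e : A) (inv : A → A) (P : A → Set p) : Set (a ⊔ ℓ ⊔ p) where
  field
    resp-≈  : ∀ {u v} → u ≈ v → P u → P v
    has-one : P e
    ∙-closed : ∀ {u v} → P u → P v → P (u ∙ v)
    inv-closed : ∀ {u} → P u → P (inv u)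

module GroupNotions {c ℓ} (T : Group c ℓ) where
  open Group T

  pow : Carrier → ℕ → Carrier
  pow x zero    = ε
  pow x (suc n) = x ∙ pow x n

  HasOrder : Carrier → ℕ → Set ℓ
  HasOrder x n = (0 ℕ.< n) × (pow x n ≈ ε) × (∀ m → 0 ℕ.< m → m ℕ.< n → ¬ (pow x m ≈ ε))

  IsFinite : Set (c ⊔ ℓ)
  IsFinite = Σ (List Carrier) λ l → ∀ t → Any (t ≈_) l

  IsNonAbelian : Set (c ⊔ ℓ)
  IsNonAbelian = ∃₂ λ a b → ¬ ((a ∙ b) ≈ (b ∙ a))

  record IsNormalSubgroup (P : Carrier → Set (c ⊔ ℓ)) : Set (c ⊔ ℓ) where
    field
      subgroup : IsSubgroup _≈_ _∙_ ε _⁻¹ P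
      conj     : ∀ g n → P n → P ((g ⁻¹ ∙ n) ∙ g)

  IsSimple : Set (lsuc (c ⊔ ℓ))
  IsSimple = (¬ (∀ t → t ≈ ε)) ×
             (∀ P → IsNormalSubgroup P → (∀ t → P t → t ≈ ε) ⊎ (∀ t → P t))

  ⟨_⟩ : ∀ {s} → (Carrier → Set s) → Carrier → Set (c ⊔ ℓ ⊔ s)
  ⟨ S ⟩ = Generated _≈_ _∙_ ε _⁻¹ S

-- Graphs whose vertex set carries an equivalence (needed for vertex
-- sets that are sets of cosets), and isomorphisms between them.

record Graph v e r : Set (lsuc (v ⊔ e ⊔ r)) where
  field
    V   : Set v
    _~_ : V → V → Set e     -- equality of vertices
    Arc : V → V → Set r

record GraphIso {v₁ e₁ r₁ v₂ e₂ r₂} (Γ₁ : Graph v₁ e₁ r₁) (Γ₂ : Graph v₂ e₂ r₂)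
       : Set (v₁ ⊔ e₁ ⊔ r₁ ⊔ v₂ ⊔ e₂ ⊔ r₂) where
  private
    module G₁ = Graph Γ₁
    module G₂ = Graph Γ₂
  field
    φ     : G₁.V → G₂.V
    φ-cong : ∀ {a b} → a G₁.~ b → φ a G₂.~ φ b
    φ-inj  : ∀ {a b} → φ a G₂.~ φ b → a G₁.~ b
    φ-surj : ∀ w → ∃ λ a → φ a G₂.~ w
    φ-arc  : ∀ {a b} → G₁.Arc a b → G₂.Arc (φ a) (φ b)
    φ-arc⁻ : ∀ {a b} → G₂.Arc (φ a) (φ b) → G₁.Arc a b

-- Permutations of {1,…,6} (point i is represented by Fin index i-1),
-- acting on the right:  i^σ = σ ⟨$⟩ʳ i,  and στ = "first σ then τ" = σ ∘ₚ τ.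

S6 : Set
S6 = Permutation′ 6

h₁ : S6
h₁ = permutation
  (λ { 0F → 3F ; 1F → 2F ; 2F → 4F ; 3F → 5F ; 4F → 1F ; 5F → 0F })
  (λ { 3F → 0F ; 2F → 1F ; 4F → 2F ; 5F → 3F ; 1F → 4F ; 0F → 5F })
  (λ { 0F → refl ; 1F → refl ; 2F → refl ; 3F → refl ; 4F → refl ; 5F → refl })
  (λ { 0F → refl ; 1F → refl ; 2F → refl ; 3F → refl ; 4F → refl ; 5F → refl })

h₂ : S6
h₂ = permutation
  (λ { 0F → 2F ; 2F → 0F ; 1F → 3F ; 3F → 1F ; 4F → 5F ; 5F → 4F })
  (λ { 0F → 2F ; 2F → 0F ; 1F → 3F ; 3F → 1F ; 4F → 5F ; 5F → 4F })
  (λ { 0F → refl ; 1F → refl ; 2F → refl ; 3F → refl ; 4F → refl ; 5F → refl })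
  (λ { 0F → refl ; 1F → refl ; 2F → refl ; 3F → refl ; 4F → refl ; 5F → refl })

δ : S6
δ = permutation
  (λ { 0F → 3F ; 3F → 0F ; 1F → 2F ; 2F → 1F ; 4F → 5F ; 5F → 4F })
  (λ { 0F → 3F ; 3F → 0F ; 1F → 2F ; 2F → 1F ; 4F → 5F ; 5F → 4F })
  (λ { 0F → refl ; 1F → refl ; 2F → refl ; 3F → refl ; 4F → refl ; 5F → refl })
  (λ { 0F → refl ; 1F → refl ; 2F → refl ; 3F → refl ; 4F → refl ; 5F → refl })

π₁₂₃₄ : S6
π₁₂₃₄ = permutation
  (λ { 0F → 1F ; 1F → 0F ; 2F → 3F ; 3F → 2F ; 4F → 4F ; 5F → 5F })
  (λ { 0F → 1F ; 1F → 0F ; 2F → 3F ; 3F → 2F ; 4F → 4F ; 5F → 5F })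
  (λ { 0F → refl ; 1F → refl ; 2F → refl ; 3F → refl ; 4F → refl ; 5F → refl })
  (λ { 0F → refl ; 1F → refl ; 2F → refl ; 3F → refl ; 4F → refl ; 5F → refl })

π₃₄₅₆ : S6
π₃₄₅₆ = permutation
  (λ { 0F → 0F ; 1F → 1F ; 2F → 3F ; 3F → 2F ; 4F → 5F ; 5F → 4F })
  (λ { 0F → 0F ; 1F → 1F ; 2F → 3F ; 3F → 2F ; 4F → 5F ; 5F → 4F })
  (λ { 0F → refl ; 1F → refl ; 2F → refl ; 3F → refl ; 4F → refl ; 5F → refl })
  (λ { 0F → refl ; 1F → refl ; 2F → refl ; 3F → refl ; 4F → refl ; 5F → refl })

π₁₂₅₆ : S6
π₁₂₅₆ = permutation
  (λ { 0F → 1F ; 1F → 0F ; 2F → 2F ; 3F → 3F ; 4F → 5F ; 5F → 4F })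
  (λ { 0F → 1F ; 1F → 0F ; 2F → 2F ; 3F → 3F ; 4F → 5F ; 5F → 4F })
  (λ { 0F → refl ; 1F → refl ; 2F → refl ; 3F → refl ; 4F → refl ; 5F → refl })
  (λ { 0F → refl ; 1F → refl ; 2F → refl ; 3F → refl ; 4F → refl ; 5F → refl })

-- With (t₁,…,t₆)^σ = (t_{1^{σ⁻¹}},…,t_{6^{σ⁻¹}}) one gets
--   (f σ)(f' τ) = (f · (f')^{σ⁻¹}) στ,   ((f')^{σ⁻¹})ᵢ = f'_{i^σ},
--   (f σ)⁻¹    = ((f⁻¹)^σ) σ⁻¹.

module Wreath {c ℓ} (T : Group c ℓ) where
  open Group T

  record X : Set c where
    constructor _⋊_
    field
      tup  : Fin 6 → Carrier
      perm : S6
  open X public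

  infix 4 _≈X_
  _≈X_ : X → X → Set ℓ
  a ≈X b = (∀ i → tup a i ≈ tup b i) × (perm a Perm.≈ perm b)

  infixl 7 _·_
  _·_ : X → X → X
  (f ⋊ σ) · (f′ ⋊ τ) = (λ i → f i ∙ f′ (σ ⟨$⟩ʳ i)) ⋊ (σ ∘ₚ τ)

  1X : X
  1X = (λ _ → ε) ⋊ Perm.id

  invX : X → X
  invX (f ⋊ σ) = (λ j → (f (σ ⟨$⟩ˡ j)) ⁻¹) ⋊ Perm.flip σ

  ⌜_⌝ : S6 → X
  ⌜ σ ⌝ = (λ _ → ε) ⋊ σ

  tuple : Carrier → Carrier → Carrier → Carrier → Carrier → Carrier → X
  tuple a b c′ d e f = (λ { 0F → a ; 1F → b ; 2F → c′ ; 3F → d ; 4F → e ; 5F → f }) ⋊ Perm.id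

  ⟪_⟫ : ∀ {s} → (X → Set s) → X → Set (c ⊔ ℓ ⊔ s)
  ⟪ S ⟫ = Generated _≈X_ _·_ 1X invX S

  IsSubgroupX : ∀ {p} → (X → Set p) → Set (c ⊔ ℓ ⊔ p)
  IsSubgroupX = IsSubgroup _≈X_ _·_ 1X invX

  -- the coset graph Cos(G, H, HgH) for subgroups H ≤ G of X (given as predicates):
  -- vertices: right cosets Hz (z ∈ G), represented by z with Hz = Hw iff z w⁻¹ ∈ H;
  -- arc (Hz, Hw) iff w z⁻¹ ∈ HgH.
  CosGraph : ∀ {p q} → (X → Set p) → (X → Set q) → X → Graph (c ⊔ p) q (c ⊔ ℓ ⊔ q)
  CosGraph G H g = record
    { V   = Σ X G
    ; _~_ = λ { (z , _) (w , _) → H (z · invX w) }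
    ; Arc = λ { (z , _) (w , _) → ∃₂ λ a b → H a × H b × ((w · invX z) ≈X ((a · g) · b)) }
    }

  CayGraph : ∀ {p q} → (X → Set p) → (X → Set q) → Graph (c ⊔ p) ℓ (c ⊔ ℓ ⊔ q)
  CayGraph C S = record
    { V   = Σ X C
    ; _~_ = λ { (a , _) (b , _) → a ≈X b }
    ; Arc = λ { (a , _) (b , _) → ∃ λ s → S s × ((b · invX a) ≈X s) }
    }

  module Construction (x y : Carrier) where

    f : X
    f = tuple y (y ⁻¹) y (y ⁻¹) x x

    g : X
    g = f · ⌜ δ ⌝

    InH : X → Set (c ⊔ ℓ)
    InH = ⟪ (λ z → (z ≈X ⌜ h₁ ⌝) ⊎ (z ≈X ⌜ h₂ ⌝)) ⟫

    InY : X → Set (c ⊔ ℓ)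
    InY = ⟪ (λ z → (z ≈X ⌜ h₁ ⌝) ⊎ (z ≈X ⌜ h₂ ⌝) ⊎ (z ≈X g)) ⟫

    InN : X → Set (c ⊔ ℓ)
    InN z = InY z × (perm z Perm.≈ Perm.id)

    Γ : Graph (c ⊔ ℓ) (c ⊔ ℓ) (c ⊔ ℓ)
    Γ = CosGraph InY InH g

    s₁ s₂ s₃ : X
    s₁ = g · ⌜ h₂ ⌝
    s₂ = ((⌜ h₂ ⌝ · ⌜ h₁ ⌝) · g) · ⌜ h₁ ⌝
    s₃ = ((⌜ h₂ ⌝ · invX ⌜ h₁ ⌝) · g) · invX ⌜ h₁ ⌝

    InS : X → Set ℓ
    InS z = (z ≈X s₁) ⊎ (z ≈X s₂) ⊎ (z ≈X s₃)

    s₁′ s₂′ s₃′ : X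
    s₁′ = (tup (tuple y (y ⁻¹) y (y ⁻¹) x x)) ⋊ π₁₂₃₄
    s₂′ = (tup (tuple x x (y ⁻¹) y y (y ⁻¹))) ⋊ π₃₄₅₆
    s₃′ = (tup (tuple (y ⁻¹) y x x (y ⁻¹) y)) ⋊ π₁₂₅₆

    -- C is the full preimage in Y of the normal subgroup ℤ₂² of S₄ ≅ Y/N, i.e.
    -- a normal subgroup of Y containing N with C/N ≅ ℤ₂² (order 4, exponent 2).
    record IsPreimageOfKlein (C : X → Set (c ⊔ ℓ)) : Set (c ⊔ ℓ) where
      field
        subgroup  : IsSubgroupX C
        C⊆Y       : ∀ z → C z → InY z
        normal    : ∀ z w → InY z → C w → C ((invX z · w) · z)
        N⊆C       : ∀ z → InN z → C z
        exponent2 : ∀ z → C z → InN (z · z)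
        reps      : Fin 4 → X
        reps∈C    : ∀ i → C (reps i)
        reps-dist : ∀ i j → ¬ (i ≡ j) → ¬ InN (reps i · invX (reps j))
        reps-cover : ∀ z → C z → ∃ λ i → InN (z · invX (reps i))

    t₁ t₂ t₃ : X
    t₁ = tuple ((y ∙ x) ∙ y) ((y ⁻¹ ∙ x) ∙ y ⁻¹) ((y ∙ y) ∙ x) ((y ⁻¹ ∙ y ⁻¹) ∙ x)
               (x ∙ (y ∙ y)) (x ∙ (y ⁻¹ ∙ y ⁻¹))
    t₂ = tuple ((y ∙ y) ∙ x) ((y ⁻¹ ∙ y ⁻¹) ∙ x) ((y ∙ x) ∙ y) ((y ⁻¹ ∙ x) ∙ y ⁻¹)
               (x ∙ (y ⁻¹ ∙ y ⁻¹)) (x ∙ (y ∙ y))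
    t₃ = tuple (x ∙ (y ∙ y)) (x ∙ (y ⁻¹ ∙ y ⁻¹)) ((y ⁻¹ ∙ y ⁻¹) ∙ x) ((y ∙ y) ∙ x)
               ((y ∙ x) ∙ y) ((y ⁻¹ ∙ x) ∙ y ⁻¹)

    InT : X → Set ℓ
    InT z = (z ≈X t₁) ⊎ (z ≈X t₂) ⊎ (z ≈X t₃)

{-# OPTIONS --safe #-}
module Submission where

-- Both parts are finite computations once two reductions are made. The T⁶-parts of the elements
-- that occur are words in x and y, compared by free reduction modulo x² = 1. The permutation
-- parts of Y form a group P ≅ S₄ of 24 permutations preserving the blocks {1,2}, {3,4}, {5,6};
-- each element of P is realised by an explicit word in h₁, h₂, g.
-- (2) is Schreier's lemma: each Schreier generator r_a u r_{au}⁻¹ (a ∈ P, u ∈ {h₁, h₂, g}) is a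
-- word of length at most two in t₁, t₂, t₃; conversely each tᵢ is a word in h₁, h₂, g.
-- (1) The image of C in P is a normal subgroup of exponent 2 and order > 1, hence the Klein group
-- V of block-preserving elements of P, so C = {z ∈ Y : z preserves the blocks}. As H ≅ S₃ meets V
-- trivially and maps onto P/V, it is a complement to C in Y, and then z ↦ h_z z (with h_z ∈ H,
-- h_z z ∈ C) identifies Cos(Y, H, HgH) with Cay(C, HgH ∩ C), where HgH ∩ C = {s₁, s₂, s₃}.

open import Defs
open import Level using (_⊔_; 0ℓ)
open import Algebra.Bundles using (Group)
import Algebra.Properties.Group as GroupProperties
import Algebra.Properties.Monoid as MonoidProperties
open import Data.Bool using (if_then_else_; _∧_)
open import Data.Empty using (⊥-elim)
open import Data.Fin using (Fin; toℕ)
open import Data.Fin.Patterns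
open import Data.Fin.Permutation as Perm using (Permutation′; _⟨$⟩ʳ_; _⟨$⟩ˡ_; _∘ₚ_)
open import Data.Fin.Properties using (all?; any?) renaming (_≟_ to _≟ᶠ_)
open import Data.List using (List; []; _∷_)
open import Data.List.Properties using (≡-dec)
open import Data.Nat using (ℕ; _≡ᵇ_)
open import Data.Nat.Divisibility using (_∣_)
open import Data.Nat.Primality using (Prime)
open import Data.Product using (∃; ∃₂; _×_; _,_; proj₁; proj₂)
open import Data.Sum using (_⊎_; inj₁; inj₂)
open import Data.Vec using (Vec; lookup; _∷_; [])
open import Function.Bundles using (_⇔_; mk⇔)
open import Relation.Binary using (DecidableEquality)
open import Relation.Binary.PropositionalEquality as ≡ using (_≡_)
open import Relation.Nullary using (Dec; yes; no; ¬_; does)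
open import Relation.Nullary.Decidable using (_×-dec_; _→-dec_; ¬?; from-yes; map′)

module _ {a ℓ s} {A : Set a} {_≈_ : A → A → Set ℓ} {_∙_ : A → A → A} {e : A} {inv : A → A}
         {S : A → Set s} where

  Generated-isSubgroup : IsSubgroup _≈_ _∙_ e inv (Generated _≈_ _∙_ e inv S)
  Generated-isSubgroup = record { resp-≈ = resp ; has-one = one ; ∙-closed = mul ; inv-closed = invc }

  Generated-⊆ : ∀ {p} {P : A → Set p} → IsSubgroup _≈_ _∙_ e inv P → (∀ {u} → S u → P u) →
                ∀ {u} → Generated _≈_ _∙_ e inv S u → P u
  Generated-⊆ {P = P} P-subgroup S⊆P = go
    where
    open IsSubgroup P-subgroup
    go : ∀ {u} → Generated _≈_ _∙_ e inv S u → P u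
    go (gen u∈S)    = S⊆P u∈S
    go one          = has-one
    go (mul u v)    = ∙-closed (go u) (go v)
    go (invc u)     = inv-closed (go u)
    go (resp u≈v u) = resp-≈ u≈v (go u)

-- Symmetric groups and the wreath product

infix 4 _≈ₚ_
record _≈ₚ_ {n} (σ τ : Permutation′ n) : Set where
  constructor mk≈ₚ
  field ≈ₚ⇒≈ : σ Perm.≈ τ
open _≈ₚ_

∘ₚ-cong : ∀ {n} {σ σ′ τ τ′ : Permutation′ n} → σ ≈ₚ σ′ → τ ≈ₚ τ′ → σ ∘ₚ τ ≈ₚ σ′ ∘ₚ τ′
∘ₚ-cong {σ′ = σ′} {τ} (mk≈ₚ σ≈σ′) (mk≈ₚ τ≈τ′) =
  mk≈ₚ λ i → ≡.trans (≡.cong (τ ⟨$⟩ʳ_) (σ≈σ′ i)) (τ≈τ′ (σ′ ⟨$⟩ʳ i))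

flip-cong : ∀ {n} {σ τ : Permutation′ n} → σ ≈ₚ τ → Perm.flip σ ≈ₚ Perm.flip τ
flip-cong {σ = σ} {τ} (mk≈ₚ σ≈τ) = mk≈ₚ λ i → begin
  σ ⟨$⟩ˡ i                          ≡⟨ Perm.inverseˡ τ ⟨
  τ ⟨$⟩ˡ (τ ⟨$⟩ʳ (σ ⟨$⟩ˡ i))          ≡⟨ ≡.cong (τ ⟨$⟩ˡ_) (σ≈τ _) ⟨
  τ ⟨$⟩ˡ (σ ⟨$⟩ʳ (σ ⟨$⟩ˡ i))          ≡⟨ ≡.cong (τ ⟨$⟩ˡ_) (Perm.inverseʳ σ) ⟩
  τ ⟨$⟩ˡ i                          ∎
  where open ≡.≡-Reasoning

symmetricGroup : ℕ → Group 0ℓ 0ℓ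
symmetricGroup n = record
  { Carrier = Permutation′ n
  ; _≈_     = _≈ₚ_
  ; _∙_     = _∘ₚ_
  ; ε       = Perm.id
  ; _⁻¹     = Perm.flip
  ; isGroup = record
    { isMonoid = record
      { isSemigroup = record
        { isMagma = record
          { isEquivalence = record
            { refl  = mk≈ₚ λ _ → ≡.refl
            ; sym   = λ (mk≈ₚ σ≈τ) → mk≈ₚ λ i → ≡.sym (σ≈τ i)
            ; trans = λ (mk≈ₚ σ≈τ) (mk≈ₚ τ≈ρ) → mk≈ₚ λ i → ≡.trans (σ≈τ i) (τ≈ρ i)
            }
          ; ∙-cong = ∘ₚ-cong
          }
        ; assoc = λ _ _ _ → mk≈ₚ λ _ → ≡.refl
        }
      ; identity = (λ _ → mk≈ₚ λ _ → ≡.refl) , (λ _ → mk≈ₚ λ _ → ≡.refl)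
      }
    ; inverse = (λ σ → mk≈ₚ λ _ → Perm.inverseʳ σ) , (λ σ → mk≈ₚ λ _ → Perm.inverseˡ σ)
    ; ⁻¹-cong = flip-cong
    }
  }

module S₆ = Group (symmetricGroup 6)

module GroupLemmas {c ℓ} (G : Group c ℓ) where
  open Group G
  open GroupProperties G using (ε⁻¹≈ε; ⁻¹-involutive; ⁻¹-anti-homo-∙)
  open MonoidProperties monoid using (cancelˡ; cancelʳ; cancelᶜ)
  open import Relation.Binary.Reasoning.Setoid setoid

  xε∙x⁻¹≈ε : ∀ x → x ∙ ε ∙ x ⁻¹ ≈ ε
  xε∙x⁻¹≈ε x = trans (∙-congʳ (identityʳ x)) (inverseʳ x)

  εx∙ε⁻¹≈x : ∀ x → ε ∙ x ∙ ε ⁻¹ ≈ x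
  εx∙ε⁻¹≈x x = trans (∙-cong (identityˡ x) ε⁻¹≈ε) (identityʳ x)

  [xy∙z⁻¹][zu∙v⁻¹]≈x[yu]∙v⁻¹ : ∀ x y z u v → (x ∙ y ∙ z ⁻¹) ∙ (z ∙ u ∙ v ⁻¹) ≈ x ∙ (y ∙ u) ∙ v ⁻¹
  [xy∙z⁻¹][zu∙v⁻¹]≈x[yu]∙v⁻¹ x y z u v = begin
    (x ∙ y ∙ z ⁻¹) ∙ (z ∙ u ∙ v ⁻¹)   ≈⟨ assoc _ _ _ ⟨
    (x ∙ y ∙ z ⁻¹) ∙ (z ∙ u) ∙ v ⁻¹   ≈⟨ ∙-congʳ (cancelᶜ (inverseˡ z) (x ∙ y) u) ⟩
    x ∙ y ∙ u ∙ v ⁻¹                  ≈⟨ ∙-congʳ (assoc x y u) ⟩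
    x ∙ (y ∙ u) ∙ v ⁻¹                ∎

  [xy∙z⁻¹]⁻¹≈zy⁻¹∙x⁻¹ : ∀ x y z → (x ∙ y ∙ z ⁻¹) ⁻¹ ≈ z ∙ y ⁻¹ ∙ x ⁻¹
  [xy∙z⁻¹]⁻¹≈zy⁻¹∙x⁻¹ x y z = begin
    (x ∙ y ∙ z ⁻¹) ⁻¹       ≈⟨ ⁻¹-anti-homo-∙ (x ∙ y) (z ⁻¹) ⟩
    z ⁻¹ ⁻¹ ∙ (x ∙ y) ⁻¹    ≈⟨ ∙-cong (⁻¹-involutive z) (⁻¹-anti-homo-∙ x y) ⟩
    z ∙ (y ⁻¹ ∙ x ⁻¹)       ≈⟨ assoc _ _ _ ⟨
    z ∙ y ⁻¹ ∙ x ⁻¹         ∎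

  xy∙[zu]⁻¹≈x[yu⁻¹]∙z⁻¹ : ∀ x y z u → (x ∙ y) ∙ (z ∙ u) ⁻¹ ≈ x ∙ (y ∙ u ⁻¹) ∙ z ⁻¹
  xy∙[zu]⁻¹≈x[yu⁻¹]∙z⁻¹ x y z u = begin
    (x ∙ y) ∙ (z ∙ u) ⁻¹      ≈⟨ ∙-congˡ (⁻¹-anti-homo-∙ z u) ⟩
    (x ∙ y) ∙ (u ⁻¹ ∙ z ⁻¹)   ≈⟨ assoc _ _ _ ⟨
    x ∙ y ∙ u ⁻¹ ∙ z ⁻¹       ≈⟨ ∙-congʳ (assoc x y (u ⁻¹)) ⟩
    x ∙ (y ∙ u ⁻¹) ∙ z ⁻¹     ∎

  xyz⁻¹≈u⇒y≈x⁻¹uz : ∀ x y z {u} → x ∙ y ∙ z ⁻¹ ≈ u → y ≈ x ⁻¹ ∙ u ∙ z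
  xyz⁻¹≈u⇒y≈x⁻¹uz x y z {u} xyz⁻¹≈u = begin
    y                           ≈⟨ cancelˡ (inverseˡ x) y ⟨
    x ⁻¹ ∙ (x ∙ y)              ≈⟨ cancelʳ (inverseˡ z) _ ⟨
    x ⁻¹ ∙ (x ∙ y) ∙ z ⁻¹ ∙ z   ≈⟨ ∙-congʳ (assoc _ _ _) ⟩
    x ⁻¹ ∙ (x ∙ y ∙ z ⁻¹) ∙ z   ≈⟨ ∙-congʳ (∙-congˡ xyz⁻¹≈u) ⟩
    x ⁻¹ ∙ u ∙ z                ∎

  x[yz∙u]∙v≈xy∙z∙uv : ∀ x y z u v → x ∙ (y ∙ z ∙ u) ∙ v ≈ x ∙ y ∙ z ∙ (u ∙ v)
  x[yz∙u]∙v≈xy∙z∙uv x y z u v = begin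
    x ∙ (y ∙ z ∙ u) ∙ v     ≈⟨ ∙-congʳ (assoc _ _ _) ⟨
    x ∙ (y ∙ z) ∙ u ∙ v     ≈⟨ ∙-congʳ (∙-congʳ (assoc _ _ _)) ⟨
    x ∙ y ∙ z ∙ u ∙ v       ≈⟨ assoc _ _ _ ⟩
    x ∙ y ∙ z ∙ (u ∙ v)     ∎

module WreathGroup {c ℓ} (T : Group c ℓ) where
  open Group T
  open GroupProperties T using (ε⁻¹≈ε)
  open Wreath T

  -- _≈X_ unfolds to a product, from which Agda cannot recover its arguments.
  infix 4 _≋_
  record _≋_ (a b : X) : Set ℓ where
    constructor ≈X⇒≋
    field ≋⇒≈X : a ≈X b
  open _≋_ public

  perm-cong : ∀ {a b} → a ≋ b → perm a ≈ₚ perm b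
  perm-cong (≈X⇒≋ (_ , σ≈τ)) = mk≈ₚ σ≈τ

  ≋-refl : ∀ {a} → a ≋ a
  ≋-refl = ≈X⇒≋ ((λ _ → refl) , (λ _ → ≡.refl))

  ≋-sym : ∀ {a b} → a ≋ b → b ≋ a
  ≋-sym (≈X⇒≋ (f≈g , σ≈τ)) = ≈X⇒≋ ((λ i → sym (f≈g i)) , (λ i → ≡.sym (σ≈τ i)))

  ≋-trans : ∀ {a b d} → a ≋ b → b ≋ d → a ≋ d
  ≋-trans (≈X⇒≋ (f≈g , σ≈τ)) (≈X⇒≋ (g≈h , τ≈ρ)) =
    ≈X⇒≋ ((λ i → trans (f≈g i) (g≈h i)) , (λ i → ≡.trans (σ≈τ i) (τ≈ρ i)))

  ·-cong : ∀ {a a′ b b′} → a ≋ a′ → b ≋ b′ → a · b ≋ a′ · b′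
  ·-cong {a} {a′} {b} {b′} (≈X⇒≋ (f≈f′ , σ≈σ′)) (≈X⇒≋ (g≈g′ , τ≈τ′)) = ≈X⇒≋
    ( (λ i → ∙-cong (f≈f′ i) (trans (g≈g′ _) (reflexive (≡.cong (tup b′) (σ≈σ′ i)))))
    , ≈ₚ⇒≈ (∘ₚ-cong {σ = perm a} {perm a′} {perm b} {perm b′} (mk≈ₚ σ≈σ′) (mk≈ₚ τ≈τ′)) )

  invX-cong : ∀ {a b} → a ≋ b → invX a ≋ invX b
  invX-cong {a} {b} (≈X⇒≋ (f≈g , σ≈τ)) = ≈X⇒≋
    ( (λ j → ⁻¹-cong (trans (f≈g _) (reflexive (≡.cong (tup b) (flip-σ≈flip-τ j)))))
    , flip-σ≈flip-τ )
    where
    flip-σ≈flip-τ : Perm.flip (perm a) Perm.≈ Perm.flip (perm b)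
    flip-σ≈flip-τ = ≈ₚ⇒≈ (flip-cong {σ = perm a} {perm b} (mk≈ₚ σ≈τ))

  wreathGroup : Group c ℓ
  wreathGroup = record
    { Carrier = X
    ; _≈_     = _≋_
    ; _∙_     = _·_
    ; ε       = 1X
    ; _⁻¹     = invX
    ; isGroup = record
      { isMonoid = record
        { isSemigroup = record
          { isMagma = record
            { isEquivalence = record { refl = ≋-refl ; sym = ≋-sym ; trans = ≋-trans }
            ; ∙-cong = ·-cong
            }
          ; assoc = λ _ _ _ → ≈X⇒≋ ((λ _ → assoc _ _ _) , (λ _ → ≡.refl))
          }
        ; identity = (λ _ → ≈X⇒≋ ((λ _ → identityˡ _) , (λ _ → ≡.refl)))
                   , (λ _ → ≈X⇒≋ ((λ _ → identityʳ _) , (λ _ → ≡.refl)))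
        }
      ; inverse = (λ a → ≈X⇒≋ ((λ _ → inverseˡ _) , (λ _ → Perm.inverseʳ (perm a))))
                , (λ a → ≈X⇒≋ ( (λ _ → trans (∙-congˡ (⁻¹-cong (reflexive (≡.cong (tup a) (Perm.inverseˡ (perm a))))))
                                           (inverseʳ _))
                              , (λ _ → Perm.inverseˡ (perm a)) ))
      ; ⁻¹-cong = invX-cong
      }
    }

  ⌜⌝-cong : ∀ {σ τ} → σ ≈ₚ τ → ⌜ σ ⌝ ≋ ⌜ τ ⌝
  ⌜⌝-cong (mk≈ₚ σ≈τ) = ≈X⇒≋ ((λ _ → refl) , σ≈τ)

  ⌜⌝-∘ₚ : ∀ σ τ → ⌜ σ ⌝ · ⌜ τ ⌝ ≋ ⌜ σ ∘ₚ τ ⌝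
  ⌜⌝-∘ₚ σ τ = ≈X⇒≋ ((λ _ → identityˡ ε) , (λ _ → ≡.refl))

  ⌜⌝-flip : ∀ σ → invX ⌜ σ ⌝ ≋ ⌜ Perm.flip σ ⌝
  ⌜⌝-flip σ = ≈X⇒≋ ((λ _ → ε⁻¹≈ε) , (λ _ → ≡.refl))

-- Words in x and y modulo x² = 1, and symbolic elements of the wreath product

SquaresToOne : ∀ {c ℓ} (T : Group c ℓ) → Group.Carrier T → Set ℓ
SquaresToOne T x = x ∙ x ≈ ε
  where open Group T

data Letter : Set where
  x⁺ y⁺ y⁻ : Letter

_≟ˡ_ : DecidableEquality Letter
x⁺ ≟ˡ x⁺ = yes ≡.refl
x⁺ ≟ˡ y⁺ = no λ ()
x⁺ ≟ˡ y⁻ = no λ ()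
y⁺ ≟ˡ x⁺ = no λ ()
y⁺ ≟ˡ y⁺ = yes ≡.refl
y⁺ ≟ˡ y⁻ = no λ ()
y⁻ ≟ˡ x⁺ = no λ ()
y⁻ ≟ˡ y⁺ = no λ ()
y⁻ ≟ˡ y⁻ = yes ≡.refl

letter⁻¹ : Letter → Letter
letter⁻¹ x⁺ = x⁺
letter⁻¹ y⁺ = y⁻
letter⁻¹ y⁻ = y⁺

Word : Set
Word = List Letter

infixr 5 _◁_ _⊙_
_◁_ : Letter → Word → Word
l ◁ [] = l ∷ []
l ◁ (m ∷ w) with letter⁻¹ l ≟ˡ m
... | yes _ = w
... | no _  = l ∷ m ∷ w

_⊙_ : Word → Word → Word
[] ⊙ v      = v
(l ∷ u) ⊙ v = l ◁ u ⊙ v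

word⁻¹ : Word → Word
word⁻¹ []      = []
word⁻¹ (l ∷ w) = word⁻¹ w ⊙ letter⁻¹ l ∷ []

infixl 7 _⊗_
data Term : Set where
  𝕩 𝕪 𝟙 : Term
  _⊗_   : Term → Term → Term
  _⁻¹ᵀ  : Term → Term

nf : Term → Word
nf 𝕩        = x⁺ ∷ []
nf 𝕪        = y⁺ ∷ []
nf 𝟙        = []
nf (a ⊗ b)  = nf a ⊙ nf b
nf (a ⁻¹ᵀ)  = word⁻¹ (nf a)

record Sym : Set where
  constructor _⋊ₛ_
  field
    entry : Fin 6 → Term
    shape : S6
open Sym

infixl 7 _⊛_
_⊛_ : Sym → Sym → Sym
(v ⋊ₛ σ) ⊛ (w ⋊ₛ τ) = (λ i → v i ⊗ w (σ ⟨$⟩ʳ i)) ⋊ₛ (σ ∘ₚ τ)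

_⁻¹ₛ : Sym → Sym
(v ⋊ₛ σ) ⁻¹ₛ = (λ j → v (σ ⟨$⟩ˡ j) ⁻¹ᵀ) ⋊ₛ Perm.flip σ

⌜_⌝ₛ : S6 → Sym
⌜ σ ⌝ₛ = (λ _ → 𝟙) ⋊ₛ σ

tupleₛ : Term → Term → Term → Term → Term → Term → Fin 6 → Term
tupleₛ a b c d e f 0F = a
tupleₛ a b c d e f 1F = b
tupleₛ a b c d e f 2F = c
tupleₛ a b c d e f 3F = d
tupleₛ a b c d e f 4F = e
tupleₛ a b c d e f 5F = f

infix 4 _≈ₚ?_ _≐_ _≐?_
_≈ₚ?_ : (σ τ : S6) → Dec (σ ≈ₚ τ)
σ ≈ₚ? τ = map′ mk≈ₚ ≈ₚ⇒≈ (all? λ i → σ ⟨$⟩ʳ i ≟ᶠ τ ⟨$⟩ʳ i)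

record _≐_ (a b : Sym) : Set where
  constructor mk≐
  field
    same-nf    : ∀ i → nf (entry a i) ≡ nf (entry b i)
    same-shape : shape a ≈ₚ shape b

_≐?_ : (a b : Sym) → Dec (a ≐ b)
a ≐? b = map′ (λ (same-nf , same-shape) → mk≐ same-nf same-shape)
              (λ (mk≐ same-nf same-shape) → same-nf , same-shape)
              ((all? λ i → ≡-dec _≟ˡ_ (nf (entry a i)) (nf (entry b i))) ×-dec (shape a ≈ₚ? shape b))

data Signed (n : ℕ) : Set where
  ↑_ ↓_ : Fin n → Signed n

evalWord : ∀ {n} → (Fin n → Sym) → List (Signed n) → Sym
evalWord γ []          = ⌜ Perm.id ⌝ₛ
evalWord γ (↑ i ∷ w)   = γ i ⊛ evalWord γ w
evalWord γ (↓ i ∷ w)   = γ i ⁻¹ₛ ⊛ evalWord γ w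

-- The image P of Y in S₆, and the finite checks

fₛ gₛ : Sym
fₛ = tupleₛ 𝕪 (𝕪 ⁻¹ᵀ) 𝕪 (𝕪 ⁻¹ᵀ) 𝕩 𝕩 ⋊ₛ Perm.id
gₛ = fₛ ⊛ ⌜ δ ⌝ₛ

yGen : Fin 3 → Sym
yGen 0F = ⌜ h₁ ⌝ₛ
yGen 1F = ⌜ h₂ ⌝ₛ
yGen 2F = gₛ

hGen : Fin 2 → Sym
hGen 0F = ⌜ h₁ ⌝ₛ
hGen 1F = ⌜ h₂ ⌝ₛ

tGen : Fin 3 → Sym
tGen 0F = tupleₛ (𝕪 ⊗ 𝕩 ⊗ 𝕪) (𝕪 ⁻¹ᵀ ⊗ 𝕩 ⊗ 𝕪 ⁻¹ᵀ) (𝕪 ⊗ 𝕪 ⊗ 𝕩) (𝕪 ⁻¹ᵀ ⊗ 𝕪 ⁻¹ᵀ ⊗ 𝕩)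
                 (𝕩 ⊗ (𝕪 ⊗ 𝕪)) (𝕩 ⊗ (𝕪 ⁻¹ᵀ ⊗ 𝕪 ⁻¹ᵀ)) ⋊ₛ Perm.id
tGen 1F = tupleₛ (𝕪 ⊗ 𝕪 ⊗ 𝕩) (𝕪 ⁻¹ᵀ ⊗ 𝕪 ⁻¹ᵀ ⊗ 𝕩) (𝕪 ⊗ 𝕩 ⊗ 𝕪) (𝕪 ⁻¹ᵀ ⊗ 𝕩 ⊗ 𝕪 ⁻¹ᵀ)
                 (𝕩 ⊗ (𝕪 ⁻¹ᵀ ⊗ 𝕪 ⁻¹ᵀ)) (𝕩 ⊗ (𝕪 ⊗ 𝕪)) ⋊ₛ Perm.id
tGen 2F = tupleₛ (𝕩 ⊗ (𝕪 ⊗ 𝕪)) (𝕩 ⊗ (𝕪 ⁻¹ᵀ ⊗ 𝕪 ⁻¹ᵀ)) (𝕪 ⁻¹ᵀ ⊗ 𝕪 ⁻¹ᵀ ⊗ 𝕩) (𝕪 ⊗ 𝕪 ⊗ 𝕩)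
                 (𝕪 ⊗ 𝕩 ⊗ 𝕪) (𝕪 ⁻¹ᵀ ⊗ 𝕩 ⊗ 𝕪 ⁻¹ᵀ) ⋊ₛ Perm.id

sₛ s′ₛ : Fin 3 → Sym
sₛ 0F = gₛ ⊛ ⌜ h₂ ⌝ₛ
sₛ 1F = ⌜ h₂ ⌝ₛ ⊛ ⌜ h₁ ⌝ₛ ⊛ gₛ ⊛ ⌜ h₁ ⌝ₛ
sₛ 2F = ⌜ h₂ ⌝ₛ ⊛ ⌜ h₁ ⌝ₛ ⁻¹ₛ ⊛ gₛ ⊛ ⌜ h₁ ⌝ₛ ⁻¹ₛ
s′ₛ 0F = tupleₛ 𝕪 (𝕪 ⁻¹ᵀ) 𝕪 (𝕪 ⁻¹ᵀ) 𝕩 𝕩 ⋊ₛ π₁₂₃₄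
s′ₛ 1F = tupleₛ 𝕩 𝕩 (𝕪 ⁻¹ᵀ) 𝕪 𝕪 (𝕪 ⁻¹ᵀ) ⋊ₛ π₃₄₅₆
s′ₛ 2F = tupleₛ (𝕪 ⁻¹ᵀ) 𝕪 𝕩 𝕩 (𝕪 ⁻¹ᵀ) 𝕪 ⋊ₛ π₁₂₅₆

repWords : Vec (List (Signed 3)) 24
repWords =
    []
  ∷ (↑ 0F ∷ [])
  ∷ (↑ 1F ∷ [])
  ∷ (↑ 2F ∷ [])
  ∷ (↑ 0F ∷ ↑ 0F ∷ [])
  ∷ (↑ 0F ∷ ↑ 1F ∷ [])
  ∷ (↑ 0F ∷ ↑ 2F ∷ [])
  ∷ (↑ 1F ∷ ↑ 0F ∷ [])
  ∷ (↑ 1F ∷ ↑ 2F ∷ [])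
  ∷ (↑ 2F ∷ ↑ 0F ∷ [])
  ∷ (↑ 0F ∷ ↑ 0F ∷ ↑ 2F ∷ [])
  ∷ (↑ 0F ∷ ↑ 1F ∷ ↑ 2F ∷ [])
  ∷ (↑ 0F ∷ ↑ 2F ∷ ↑ 0F ∷ [])
  ∷ (↑ 1F ∷ ↑ 0F ∷ ↑ 2F ∷ [])
  ∷ (↑ 1F ∷ ↑ 2F ∷ ↑ 0F ∷ [])
  ∷ (↑ 2F ∷ ↑ 0F ∷ ↑ 0F ∷ [])
  ∷ (↑ 2F ∷ ↑ 0F ∷ ↑ 1F ∷ [])
  ∷ (↑ 2F ∷ ↑ 0F ∷ ↑ 2F ∷ [])
  ∷ (↑ 0F ∷ ↑ 0F ∷ ↑ 2F ∷ ↑ 0F ∷ [])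
  ∷ (↑ 0F ∷ ↑ 2F ∷ ↑ 0F ∷ ↑ 0F ∷ [])
  ∷ (↑ 0F ∷ ↑ 2F ∷ ↑ 0F ∷ ↑ 1F ∷ [])
  ∷ (↑ 0F ∷ ↑ 2F ∷ ↑ 0F ∷ ↑ 2F ∷ [])
  ∷ (↑ 2F ∷ ↑ 0F ∷ ↑ 0F ∷ ↑ 2F ∷ [])
  ∷ (↑ 0F ∷ ↑ 0F ∷ ↑ 2F ∷ ↑ 0F ∷ ↑ 0F ∷ [])
  ∷ []

rep : Fin 24 → Sym
rep a = evalWord yGen (lookup repWords a)

repPerm : Fin 24 → S6
repPerm a = shape (rep a)

-- An element of P is determined by the images of 1 and 3; junk value 0 outside P.
locate : Fin 6 → Fin 6 → Fin 24
locate i j with any? (λ a → (repPerm a ⟨$⟩ʳ 0F ≟ᶠ i) ×-dec (repPerm a ⟨$⟩ʳ 2F ≟ᶠ j))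
... | yes (a , _) = a
... | no _        = 0F

-- Opaque, so that comparing two indices never unfolds the search in locate.
opaque
  index : S6 → Fin 24
  index σ = locate (σ ⟨$⟩ʳ 0F) (σ ⟨$⟩ʳ 2F)

  index-cong : ∀ {σ τ} → σ ≈ₚ τ → index σ ≡ index τ
  index-cong (mk≈ₚ σ≈τ) = ≡.cong₂ locate (σ≈τ 0F) (σ≈τ 2F)

InP : S6 → Set
InP σ = repPerm (index σ) ≈ₚ σ

-- The checks are opaque: they are used only through their statements, and unfolding
-- one would rerun its decision procedure.
opaque
  unfolding index

  index-repPerm : ∀ a → index (repPerm a) ≡ a
  index-repPerm = from-yes (all? λ a → index (repPerm a) ≟ᶠ a)

  repPerm-∘ₚ : ∀ a b → InP (repPerm a ∘ₚ repPerm b)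
  repPerm-∘ₚ = from-yes (all? λ a → all? λ b →
    repPerm (index (repPerm a ∘ₚ repPerm b)) ≈ₚ? repPerm a ∘ₚ repPerm b)

  repPerm-flip : ∀ a → InP (Perm.flip (repPerm a))
  repPerm-flip = from-yes (all? λ a → repPerm (index (Perm.flip (repPerm a))) ≈ₚ? Perm.flip (repPerm a))

  yGen∈P : ∀ i → InP (shape (yGen i))
  yGen∈P = from-yes (all? λ i → repPerm (index (shape (yGen i))) ≈ₚ? shape (yGen i))

InP-resp : ∀ {σ τ} → σ ≈ₚ τ → InP σ → InP τ
InP-resp {σ} {τ} σ≈τ σ∈P =
  S₆.trans (S₆.reflexive (≡.cong repPerm (index-cong {τ} {σ} (S₆.sym σ≈τ)))) (S₆.trans σ∈P σ≈τ)

repPerm∈P : ∀ a → InP (repPerm a)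
repPerm∈P a = S₆.reflexive (≡.cong repPerm (index-repPerm a))

InP-∘ₚ : ∀ {σ τ} → InP σ → InP τ → InP (σ ∘ₚ τ)
InP-∘ₚ {σ} {τ} σ∈P τ∈P =
  InP-resp {repPerm (index σ) ∘ₚ repPerm (index τ)} (S₆.∙-cong σ∈P τ∈P) (repPerm-∘ₚ (index σ) (index τ))

InP-flip : ∀ {σ} → InP σ → InP (Perm.flip σ)
InP-flip {σ} σ∈P = InP-resp {Perm.flip (repPerm (index σ))} (S₆.⁻¹-cong σ∈P) (repPerm-flip (index σ))

infixl 7 _·ᵢ_
_·ᵢ_ : Fin 24 → S6 → Fin 24
a ·ᵢ σ = index (repPerm a ∘ₚ σ)

·ᵢ-cong : ∀ a {σ τ} → σ ≈ₚ τ → a ·ᵢ σ ≡ a ·ᵢ τ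
·ᵢ-cong a {σ} {τ} σ≈τ = index-cong {repPerm a ∘ₚ σ} {repPerm a ∘ₚ τ} (S₆.∙-congˡ {repPerm a} σ≈τ)

·ᵢ-id : ∀ a → a ·ᵢ Perm.id ≡ a
·ᵢ-id a = ≡.trans (index-cong {repPerm a ∘ₚ Perm.id} {repPerm a} (S₆.identityʳ (repPerm a))) (index-repPerm a)

·ᵢ-∘ₚ : ∀ a {σ} τ → InP σ → a ·ᵢ σ ·ᵢ τ ≡ a ·ᵢ (σ ∘ₚ τ)
·ᵢ-∘ₚ a {σ} τ σ∈P = index-cong {repPerm (a ·ᵢ σ) ∘ₚ τ} {repPerm a ∘ₚ (σ ∘ₚ τ)}
  (S₆.trans (S₆.∙-congʳ {τ} (InP-∘ₚ {repPerm a} {σ} (repPerm∈P a) σ∈P)) (S₆.assoc (repPerm a) σ τ))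

·ᵢ-flip-· : ∀ a {σ} → InP σ → a ·ᵢ Perm.flip σ ·ᵢ σ ≡ a
·ᵢ-flip-· a {σ} σ∈P = begin
  a ·ᵢ Perm.flip σ ·ᵢ σ         ≡⟨ ·ᵢ-∘ₚ a {Perm.flip σ} σ (InP-flip {σ} σ∈P) ⟩
  a ·ᵢ (Perm.flip σ ∘ₚ σ)       ≡⟨ ·ᵢ-cong a {Perm.flip σ ∘ₚ σ} {Perm.id} (S₆.inverseˡ σ) ⟩
  a ·ᵢ Perm.id                  ≡⟨ ·ᵢ-id a ⟩
  a                             ∎
  where open ≡.≡-Reasoning

tWord : Fin 3 → List (Signed 3)
tWord 0F = ↑ 2F ∷ ↑ 0F ∷ ↑ 1F ∷ ↑ 2F ∷ ↓ 0F ∷ ↓ 0F ∷ ↓ 2F ∷ ↓ 0F ∷ []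
tWord 1F = ↑ 1F ∷ ↑ 2F ∷ ↑ 0F ∷ ↑ 2F ∷ ↓ 0F ∷ ↓ 2F ∷ ↓ 0F ∷ ↓ 0F ∷ []
tWord 2F = ↑ 1F ∷ ↑ 0F ∷ ↑ 2F ∷ ↑ 0F ∷ ↓ 2F ∷ ↓ 0F ∷ ↓ 2F ∷ ↓ 0F ∷ []

opaque
  tGen-tWord : ∀ i → tGen i ≐ evalWord yGen (tWord i)
  tGen-tWord = from-yes (all? λ i → tGen i ≐? evalWord yGen (tWord i))

schreierGenerator : Fin 24 → Fin 3 → Sym
schreierGenerator a i = rep a ⊛ yGen i ⊛ rep (a ·ᵢ shape (yGen i)) ⁻¹ₛ

-- The Schreier generators r_a u r_{au}⁻¹ other than 1, keyed by (u, a), as words in t₁, t₂, t₃.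
nontrivialSchreierWords : List (Fin 3 × ℕ × List (Signed 3))
nontrivialSchreierWords =
    (0F , 11 , ↓ 0F ∷ [])
  ∷ (0F , 13 , ↑ 2F ∷ [])
  ∷ (0F , 17 , ↑ 0F ∷ [])
  ∷ (0F , 21 , ↓ 2F ∷ ↓ 1F ∷ [])
  ∷ (0F , 22 , ↑ 1F ∷ [])
  ∷ (1F , 17 , ↑ 0F ∷ [])
  ∷ (1F , 18 , ↓ 1F ∷ [])
  ∷ (1F , 19 , ↓ 0F ∷ [])
  ∷ (1F , 21 , ↓ 2F ∷ [])
  ∷ (1F , 22 , ↑ 1F ∷ [])
  ∷ (1F , 23 , ↑ 2F ∷ [])
  ∷ (2F , 14 , ↑ 1F ∷ [])
  ∷ (2F , 16 , ↑ 0F ∷ [])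
  ∷ (2F , 18 , ↓ 1F ∷ [])
  ∷ (2F , 19 , ↓ 0F ∷ [])
  ∷ (2F , 20 , ↓ 2F ∷ [])
  ∷ (2F , 23 , ↑ 2F ∷ [])
  ∷ []

schreierWord : Fin 24 → Fin 3 → List (Signed 3)
schreierWord a i = search nontrivialSchreierWords
  where
  search : List (Fin 3 × ℕ × List (Signed 3)) → List (Signed 3)
  search []                  = []
  search ((j , n , w) ∷ ws)  = if does (i ≟ᶠ j) ∧ (toℕ a ≡ᵇ n) then w else search ws

opaque
  unfolding index

  schreierGenerator-word : ∀ a i → schreierGenerator a i ≐ evalWord tGen (schreierWord a i)
  schreierGenerator-word = from-yes (all? λ a → all? λ i →
    schreierGenerator a i ≐? evalWord tGen (schreierWord a i))

block : Fin 6 → Fin 3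
block 0F = 0F
block 1F = 0F
block 2F = 1F
block 3F = 1F
block 4F = 2F
block 5F = 2F

FixesBlocks : S6 → Set
FixesBlocks σ = ∀ i → block (σ ⟨$⟩ʳ i) ≡ block i

fixesBlocks? : ∀ σ → Dec (FixesBlocks σ)
fixesBlocks? σ = all? λ i → block (σ ⟨$⟩ʳ i) ≟ᶠ block i

FixesBlocks-resp : ∀ {σ τ} → σ ≈ₚ τ → FixesBlocks σ → FixesBlocks τ
FixesBlocks-resp (mk≈ₚ σ≈τ) σ-fixes i = ≡.trans (≡.cong block (≡.sym (σ≈τ i))) (σ-fixes i)

infixl 10 _^_
_^_ : S6 → S6 → S6
π ^ ρ = Perm.flip ρ ∘ₚ π ∘ₚ ρ

^-congˡ : ∀ {π π′} ρ → π ≈ₚ π′ → π ^ ρ ≈ₚ π′ ^ ρ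
^-congˡ {π} {π′} ρ π≈π′ = S₆.∙-congˡ {Perm.flip ρ} {π ∘ₚ ρ} {π′ ∘ₚ ρ} (S₆.∙-congʳ {ρ} π≈π′)

square : S6 → S6
square σ = σ ∘ₚ σ

square-cong : ∀ {σ τ} → σ ≈ₚ τ → square σ ≈ₚ square τ
square-cong {σ} {τ} σ≈τ = S₆.∙-cong {σ} {τ} {σ} {τ} σ≈τ σ≈τ

opaque
  -- Why a normal subgroup of P of exponent 2 contains only block-fixing permutations.
  movesBlock⇒square≉1 : ∀ a → ¬ FixesBlocks (repPerm a) →
                     ∃ λ j → ¬ square (repPerm a ∘ₚ repPerm a ^ repPerm j) ≈ₚ Perm.id
  movesBlock⇒square≉1 = from-yes (all? λ a → ¬? (fixesBlocks? (repPerm a)) →-dec any? λ j →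
    ¬? (square (repPerm a ∘ₚ repPerm a ^ repPerm j) ≈ₚ? Perm.id))

  klein-conjugate : ∀ a b → FixesBlocks (repPerm a) → ¬ repPerm a ≈ₚ Perm.id →
                    FixesBlocks (repPerm b) → ¬ repPerm b ≈ₚ Perm.id →
                    ∃ λ j → repPerm a ^ repPerm j ≈ₚ repPerm b
  klein-conjugate = from-yes (all? λ a → all? λ b →
    fixesBlocks? (repPerm a) →-dec ¬? (repPerm a ≈ₚ? Perm.id) →-dec
    fixesBlocks? (repPerm b) →-dec ¬? (repPerm b ≈ₚ? Perm.id) →-dec
    any? λ j → repPerm a ^ repPerm j ≈ₚ? repPerm b)

hWords : Vec (List (Signed 2)) 6
hWords =
  [] ∷ (↑ 0F ∷ []) ∷ (↑ 1F ∷ []) ∷ (↑ 0F ∷ ↑ 0F ∷ []) ∷ (↑ 0F ∷ ↑ 1F ∷ []) ∷ (↑ 1F ∷ ↑ 0F ∷ []) ∷ []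

hElem : Fin 6 → Sym
hElem m = evalWord hGen (lookup hWords m)

hPerm : Fin 6 → S6
hPerm m = shape (hElem m)

opaque
  s-explicit : ∀ k → sₛ k ≐ s′ₛ k
  s-explicit = from-yes (all? λ k → sₛ k ≐? s′ₛ k)

  hElem-pure : ∀ m → hElem m ≐ ⌜ hPerm m ⌝ₛ
  hElem-pure = from-yes (all? λ m → hElem m ≐? ⌜ hPerm m ⌝ₛ)

  hPerm-∘ₚ : ∀ m n → ∃ λ k → hPerm k ≈ₚ hPerm m ∘ₚ hPerm n
  hPerm-∘ₚ = from-yes (all? λ m → all? λ n → any? λ k → hPerm k ≈ₚ? hPerm m ∘ₚ hPerm n)

  hPerm-flip : ∀ m → ∃ λ k → hPerm k ≈ₚ Perm.flip (hPerm m)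
  hPerm-flip = from-yes (all? λ m → any? λ k → hPerm k ≈ₚ? Perm.flip (hPerm m))

  hGen-hPerm : ∀ i → ∃ λ m → hPerm m ≈ₚ shape (hGen i)
  hGen-hPerm = from-yes (all? λ i → any? λ m → hPerm m ≈ₚ? shape (hGen i))

  hPerm-fixesBlocks : ∀ m → FixesBlocks (hPerm m) → hPerm m ≈ₚ Perm.id
  hPerm-fixesBlocks = from-yes (all? λ m → fixesBlocks? (hPerm m) →-dec hPerm m ≈ₚ? Perm.id)

  hPerm-transversal : ∀ a → ∃ λ m → FixesBlocks (hPerm m ∘ₚ repPerm a)
  hPerm-transversal = from-yes (all? λ a → any? λ m → fixesBlocks? (hPerm m ∘ₚ repPerm a))

  doubleCoset-fixesBlocks : ∀ i j → FixesBlocks (hPerm i ∘ₚ shape gₛ ∘ₚ hPerm j) →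
                            ∃ λ k → ⌜ hPerm i ⌝ₛ ⊛ gₛ ⊛ ⌜ hPerm j ⌝ₛ ≐ sₛ k
  doubleCoset-fixesBlocks = from-yes (all? λ i → all? λ j →
    fixesBlocks? (hPerm i ∘ₚ shape gₛ ∘ₚ hPerm j) →-dec
    any? λ k → ⌜ hPerm i ⌝ₛ ⊛ gₛ ⊛ ⌜ hPerm j ⌝ₛ ≐? sₛ k)

  s-fixesBlocks : ∀ k → FixesBlocks (shape (sₛ k))
  s-fixesBlocks = from-yes (all? λ k → fixesBlocks? (shape (sₛ k)))

module Evaluation {c ℓ} (T : Group c ℓ) (x y : Group.Carrier T) (x∙x≈ε : SquaresToOne T x) where
  open Group T
  open GroupProperties T using (ε⁻¹≈ε; ⁻¹-involutive; ⁻¹-anti-homo-∙; inverseʳ-unique)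
  open MonoidProperties monoid using (cancelˡ)
  open import Relation.Binary.Reasoning.Setoid setoid
  open Wreath T
  open WreathGroup T

  ⟦_⟧ˡ : Letter → Carrier
  ⟦ x⁺ ⟧ˡ = x
  ⟦ y⁺ ⟧ˡ = y
  ⟦ y⁻ ⟧ˡ = y ⁻¹

  ⟦_⟧ʷ : Word → Carrier
  ⟦ [] ⟧ʷ    = ε
  ⟦ l ∷ w ⟧ʷ = ⟦ l ⟧ˡ ∙ ⟦ w ⟧ʷ

  ⟦_⟧ᵀ : Term → Carrier
  ⟦ 𝕩 ⟧ᵀ     = x
  ⟦ 𝕪 ⟧ᵀ     = y
  ⟦ 𝟙 ⟧ᵀ     = ε
  ⟦ a ⊗ b ⟧ᵀ = ⟦ a ⟧ᵀ ∙ ⟦ b ⟧ᵀ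
  ⟦ a ⁻¹ᵀ ⟧ᵀ = ⟦ a ⟧ᵀ ⁻¹

  letter⁻¹-sound : ∀ l → ⟦ letter⁻¹ l ⟧ˡ ≈ ⟦ l ⟧ˡ ⁻¹
  letter⁻¹-sound x⁺ = inverseʳ-unique x x x∙x≈ε
  letter⁻¹-sound y⁺ = refl
  letter⁻¹-sound y⁻ = sym (⁻¹-involutive y)

  ◁-sound : ∀ l w → ⟦ l ◁ w ⟧ʷ ≈ ⟦ l ⟧ˡ ∙ ⟦ w ⟧ʷ
  ◁-sound l []      = refl
  ◁-sound l (m ∷ w) with letter⁻¹ l ≟ˡ m
  ... | yes ≡.refl = sym (cancelˡ (trans (∙-congˡ (letter⁻¹-sound l)) (inverseʳ ⟦ l ⟧ˡ)) ⟦ w ⟧ʷ)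
  ... | no _       = refl

  ⊙-sound : ∀ u v → ⟦ u ⊙ v ⟧ʷ ≈ ⟦ u ⟧ʷ ∙ ⟦ v ⟧ʷ
  ⊙-sound [] v      = sym (identityˡ ⟦ v ⟧ʷ)
  ⊙-sound (l ∷ u) v = begin
    ⟦ l ◁ u ⊙ v ⟧ʷ               ≈⟨ ◁-sound l (u ⊙ v) ⟩
    ⟦ l ⟧ˡ ∙ ⟦ u ⊙ v ⟧ʷ           ≈⟨ ∙-congˡ (⊙-sound u v) ⟩
    ⟦ l ⟧ˡ ∙ (⟦ u ⟧ʷ ∙ ⟦ v ⟧ʷ)    ≈⟨ assoc _ _ _ ⟨
    ⟦ l ⟧ˡ ∙ ⟦ u ⟧ʷ ∙ ⟦ v ⟧ʷ      ∎

  word⁻¹-sound : ∀ w → ⟦ word⁻¹ w ⟧ʷ ≈ ⟦ w ⟧ʷ ⁻¹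
  word⁻¹-sound []      = sym ε⁻¹≈ε
  word⁻¹-sound (l ∷ w) = begin
    ⟦ word⁻¹ w ⊙ letter⁻¹ l ∷ [] ⟧ʷ         ≈⟨ ⊙-sound (word⁻¹ w) _ ⟩
    ⟦ word⁻¹ w ⟧ʷ ∙ (⟦ letter⁻¹ l ⟧ˡ ∙ ε)   ≈⟨ ∙-cong (word⁻¹-sound w) (trans (identityʳ _) (letter⁻¹-sound l)) ⟩
    ⟦ w ⟧ʷ ⁻¹ ∙ ⟦ l ⟧ˡ ⁻¹                   ≈⟨ ⁻¹-anti-homo-∙ ⟦ l ⟧ˡ ⟦ w ⟧ʷ ⟨
    (⟦ l ⟧ˡ ∙ ⟦ w ⟧ʷ) ⁻¹                    ∎

  nf-sound : ∀ t → ⟦ nf t ⟧ʷ ≈ ⟦ t ⟧ᵀ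
  nf-sound 𝕩       = identityʳ x
  nf-sound 𝕪       = identityʳ y
  nf-sound 𝟙       = refl
  nf-sound (a ⊗ b) = trans (⊙-sound (nf a) (nf b)) (∙-cong (nf-sound a) (nf-sound b))
  nf-sound (a ⁻¹ᵀ) = trans (word⁻¹-sound (nf a)) (⁻¹-cong (nf-sound a))

  nf-≡⇒≈ : ∀ {a b} → nf a ≡ nf b → ⟦ a ⟧ᵀ ≈ ⟦ b ⟧ᵀ
  nf-≡⇒≈ {a} {b} nf-a≡nf-b = trans (sym (nf-sound a)) (trans (reflexive (≡.cong ⟦_⟧ʷ nf-a≡nf-b)) (nf-sound b))

  -- A strict homomorphism: ⟦ a ⊛ b ⟧ₛ and ⟦ a ⟧ₛ · ⟦ b ⟧ₛ reduce to the same term, and so on.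
  ⟦_⟧ₛ : Sym → X
  ⟦ v ⋊ₛ σ ⟧ₛ = (λ i → ⟦ v i ⟧ᵀ) ⋊ σ

  ≐⇒≋ : ∀ {a b} → a ≐ b → ⟦ a ⟧ₛ ≋ ⟦ b ⟧ₛ
  ≐⇒≋ {a} {b} (mk≐ same-nf (mk≈ₚ same-shape)) =
    ≈X⇒≋ ((λ i → nf-≡⇒≈ {entry a i} {entry b i} (same-nf i)) , same-shape)

  ⟦evalWord⟧∈⟪⟫ : ∀ {n s} {S : X → Set s} (γ : Fin n → Sym) → (∀ i → S ⟦ γ i ⟧ₛ) →
                  ∀ w → ⟪ S ⟫ ⟦ evalWord γ w ⟧ₛ
  ⟦evalWord⟧∈⟪⟫ γ γ∈S []        = one
  ⟦evalWord⟧∈⟪⟫ γ γ∈S (↑ i ∷ w) = mul (gen (γ∈S i)) (⟦evalWord⟧∈⟪⟫ γ γ∈S w)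
  ⟦evalWord⟧∈⟪⟫ γ γ∈S (↓ i ∷ w) = mul (invc (gen (γ∈S i))) (⟦evalWord⟧∈⟪⟫ γ γ∈S w)

  ⟦tupleₛ⟧ : ∀ a b c′ d e f σ →
             ⟦ tupleₛ a b c′ d e f ⋊ₛ σ ⟧ₛ ≋ tup (tuple ⟦ a ⟧ᵀ ⟦ b ⟧ᵀ ⟦ c′ ⟧ᵀ ⟦ d ⟧ᵀ ⟦ e ⟧ᵀ ⟦ f ⟧ᵀ) ⋊ σ
  ⟦tupleₛ⟧ a b c′ d e f σ =
    ≈X⇒≋ ((λ { 0F → refl ; 1F → refl ; 2F → refl ; 3F → refl ; 4F → refl ; 5F → refl }) , λ _ → ≡.refl)

-- Coset graphs and Cayley graphs

module CosetGraphs {c ℓ} (T : Group c ℓ) where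
  open Wreath T
  open WreathGroup T
  open GroupLemmas wreathGroup
  open GroupProperties wreathGroup using (x∙y⁻¹≈ε⇒x≈y; x≈y⇒x∙y⁻¹≈ε)
  open MonoidProperties (Group.monoid wreathGroup) using (cancelʳ; elimˡ)

  InDoubleCoset : ∀ {q} → (X → Set q) → X → X → Set (c ⊔ ℓ ⊔ q)
  InDoubleCoset H g s = ∃₂ λ a b → H a × H b × s ≈X a · g · b

  record IsComplement {p q r} (Y : X → Set p) (H : X → Set q) (C : X → Set r) : Set (c ⊔ ℓ ⊔ p ⊔ q ⊔ r) where
    field
      H-subgroup   : IsSubgroupX H
      C-subgroup   : IsSubgroupX C
      C⊆Y          : ∀ {z} → C z → Y z
      H∩C-trivial  : ∀ {z} → H z → C z → z ≋ 1X
      H-factor     : ∀ {z} → Y z → X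
      H-factor∈H   : ∀ {z} (z∈Y : Y z) → H (H-factor z∈Y)
      H-factor·z∈C : ∀ {z} (z∈Y : Y z) → C (H-factor z∈Y · z)

  module _ {p q r t} {Y : X → Set p} {H : X → Set q} {C : X → Set r} {S : X → Set t}
           (complement : IsComplement Y H C) (g : X)
           (S⊆HgH : ∀ {s} → S s → InDoubleCoset H g s)
           (HgH∩C⊆S : ∀ {s} → C s → InDoubleCoset H g s → S s) where
    open IsComplement complement
    private
      module H = IsSubgroup H-subgroup
      module C = IsSubgroup C-subgroup
      module Γ = Graph (CosGraph Y H g)
      module Δ = Graph (CayGraph C S)

    φ : Γ.V → Δ.V
    φ (z , z∈Y) = H-factor z∈Y · z , H-factor·z∈C z∈Y

    φ-quotient : ∀ {z w} (z∈Y : Y z) (w∈Y : Y w) →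
                 (H-factor w∈Y · w) · invX (H-factor z∈Y · z) ≋ H-factor w∈Y · (w · invX z) · invX (H-factor z∈Y)
    φ-quotient {z} {w} z∈Y w∈Y = xy∙[zu]⁻¹≈x[yu⁻¹]∙z⁻¹ (H-factor w∈Y) w (H-factor z∈Y) z

    φ-quotient∈C : ∀ {z w} (z∈Y : Y z) (w∈Y : Y w) → C ((H-factor w∈Y · w) · invX (H-factor z∈Y · z))
    φ-quotient∈C z∈Y w∈Y = C.∙-closed (H-factor·z∈C w∈Y) (C.inv-closed (H-factor·z∈C z∈Y))

    φ-cong : ∀ {a b} → a Γ.~ b → φ a Δ.~ φ b
    φ-cong {z , z∈Y} {w , w∈Y} zw⁻¹∈H = ≋⇒≈X φz≋φw
      where
      quotient∈H : H ((H-factor z∈Y · z) · invX (H-factor w∈Y · w))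
      quotient∈H = H.resp-≈ (≋⇒≈X (≋-sym (φ-quotient w∈Y z∈Y)))
        (H.∙-closed (H.∙-closed (H-factor∈H z∈Y) zw⁻¹∈H) (H.inv-closed (H-factor∈H w∈Y)))
      φz≋φw : H-factor z∈Y · z ≋ H-factor w∈Y · w
      φz≋φw = x∙y⁻¹≈ε⇒x≈y (H-factor z∈Y · z) (H-factor w∈Y · w)
                (H∩C-trivial quotient∈H (φ-quotient∈C w∈Y z∈Y))

    φ-inj : ∀ {a b} → φ a Δ.~ φ b → a Γ.~ b
    φ-inj {z , z∈Y} {w , w∈Y} φz≈φw = H.resp-≈ (≋⇒≈X (≋-sym zw⁻¹≋))
      (H.∙-closed (H.∙-closed (H.inv-closed (H-factor∈H z∈Y)) H.has-one) (H-factor∈H w∈Y))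
      where
      zw⁻¹≋ : z · invX w ≋ invX (H-factor z∈Y) · 1X · H-factor w∈Y
      zw⁻¹≋ = xyz⁻¹≈u⇒y≈x⁻¹uz (H-factor z∈Y) (z · invX w) (H-factor w∈Y)
                (≋-trans (≋-sym (φ-quotient w∈Y z∈Y))
                         (x≈y⇒x∙y⁻¹≈ε {H-factor z∈Y · z} {H-factor w∈Y · w} (≈X⇒≋ φz≈φw)))

    φ-surj : ∀ b → ∃ λ a → φ a Δ.~ b
    φ-surj (w , w∈C) = (w , w∈Y) , ≋⇒≈X (elimˡ (H∩C-trivial (H-factor∈H w∈Y) factor∈C) w)
      where
      w∈Y : Y w
      w∈Y = C⊆Y w∈C
      factor∈C : C (H-factor w∈Y)
      factor∈C = C.resp-≈ (≋⇒≈X (cancelʳ {a = w} {c = invX w} (Group.inverseʳ wreathGroup w) (H-factor w∈Y)))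
        (C.∙-closed (H-factor·z∈C w∈Y) (C.inv-closed w∈C))

    φ-arc : ∀ {a b} → Γ.Arc a b → Δ.Arc (φ a) (φ b)
    φ-arc {z , z∈Y} {w , w∈Y} (α , β , α∈H , β∈H , wz⁻¹≈αgβ) =
      (B · w) · invX (A · z) , HgH∩C⊆S (φ-quotient∈C z∈Y w∈Y) quotient∈HgH , ≋⇒≈X (≋-refl {(B · w) · invX (A · z)})
      where
      B A : X
      B = H-factor w∈Y
      A = H-factor z∈Y
      quotient∈HgH : InDoubleCoset H g ((B · w) · invX (A · z))
      quotient∈HgH = B · α , β · invX A
                   , H.∙-closed (H-factor∈H w∈Y) α∈H , H.∙-closed β∈H (H.inv-closed (H-factor∈H z∈Y))
                   , ≋⇒≈X (≋-trans (φ-quotient z∈Y w∈Y)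
                             (≋-trans (·-cong (·-cong (≋-refl {B}) (≈X⇒≋ {w · invX z} {α · g · β} wz⁻¹≈αgβ))
                                              (≋-refl {invX A}))
                                      (x[yz∙u]∙v≈xy∙z∙uv B α g β (invX A))))

    φ-arc⁻ : ∀ {a b} → Δ.Arc (φ a) (φ b) → Γ.Arc a b
    φ-arc⁻ {z , z∈Y} {w , w∈Y} (s , s∈S , φwφz⁻¹≈s) with S⊆HgH s∈S
    ... | α , β , α∈H , β∈H , s≈αgβ =
      invX B · α , β · A
      , H.∙-closed (H.inv-closed (H-factor∈H w∈Y)) α∈H , H.∙-closed β∈H (H-factor∈H z∈Y)
      , ≋⇒≈X (≋-trans wz⁻¹≋ (≋-trans (·-cong (·-cong (≋-refl {invX B}) (≈X⇒≋ {s} {α · g · β} s≈αgβ)) (≋-refl {A}))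
                                     (x[yz∙u]∙v≈xy∙z∙uv (invX B) α g β A)))
      where
      B A : X
      B = H-factor w∈Y
      A = H-factor z∈Y
      wz⁻¹≋ : w · invX z ≋ invX B · s · A
      wz⁻¹≋ = xyz⁻¹≈u⇒y≈x⁻¹uz B (w · invX z) A
                (≋-trans (≋-sym (φ-quotient z∈Y w∈Y)) (≈X⇒≋ {(B · w) · invX (A · z)} {s} φwφz⁻¹≈s))

    cosGraph≅cayGraph : GraphIso (CosGraph Y H g) (CayGraph C S)
    cosGraph≅cayGraph = record
      { φ = φ ; φ-cong = φ-cong ; φ-inj = φ-inj ; φ-surj = φ-surj ; φ-arc = φ-arc ; φ-arc⁻ = φ-arc⁻ }

module ConstructionProperties {c ℓ} (T : Group c ℓ) (x y : Group.Carrier T) (x∙x≈ε : SquaresToOne T x) where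
  open Wreath T
  open Construction x y
  open WreathGroup T
  open GroupLemmas wreathGroup
  open MonoidProperties (Group.monoid wreathGroup) using (cancelʳ)
  open Evaluation T x y x∙x≈ε
  open CosetGraphs T
  private module S₆-props = GroupProperties (symmetricGroup 6)

  s s′ t : Fin 3 → X
  s 0F = s₁
  s 1F = s₂
  s 2F = s₃
  s′ 0F = s₁′
  s′ 1F = s₂′
  s′ 2F = s₃′
  t 0F = t₁
  t 1F = t₂
  t 2F = t₃

  ⟦fₛ⟧ : ⟦ fₛ ⟧ₛ ≋ f
  ⟦fₛ⟧ = ⟦tupleₛ⟧ _ _ _ _ _ _ _

  ⟦gₛ⟧ : ⟦ gₛ ⟧ₛ ≋ g
  ⟦gₛ⟧ = ·-cong ⟦fₛ⟧ (≋-refl {⌜ δ ⌝})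

  ⟦sₛ⟧ : ∀ k → ⟦ sₛ k ⟧ₛ ≋ s k
  ⟦sₛ⟧ 0F = ·-cong ⟦gₛ⟧ (≋-refl {⌜ h₂ ⌝})
  ⟦sₛ⟧ 1F = ·-cong (·-cong (≋-refl {⌜ h₂ ⌝ · ⌜ h₁ ⌝}) ⟦gₛ⟧) (≋-refl {⌜ h₁ ⌝})
  ⟦sₛ⟧ 2F = ·-cong (·-cong (≋-refl {⌜ h₂ ⌝ · invX ⌜ h₁ ⌝}) ⟦gₛ⟧) (≋-refl {invX ⌜ h₁ ⌝})

  ⟦s′ₛ⟧ : ∀ k → ⟦ s′ₛ k ⟧ₛ ≋ s′ k
  ⟦s′ₛ⟧ 0F = ⟦tupleₛ⟧ _ _ _ _ _ _ _
  ⟦s′ₛ⟧ 1F = ⟦tupleₛ⟧ _ _ _ _ _ _ _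
  ⟦s′ₛ⟧ 2F = ⟦tupleₛ⟧ _ _ _ _ _ _ _

  ⟦tGen⟧ : ∀ i → ⟦ tGen i ⟧ₛ ≋ t i
  ⟦tGen⟧ 0F = ⟦tupleₛ⟧ _ _ _ _ _ _ _
  ⟦tGen⟧ 1F = ⟦tupleₛ⟧ _ _ _ _ _ _ _
  ⟦tGen⟧ 2F = ⟦tupleₛ⟧ _ _ _ _ _ _ _

  explicit-forms : s₁ ≈X s₁′ × s₂ ≈X s₂′ × s₃ ≈X s₃′
  explicit-forms = ≋⇒≈X (s≋s′ 0F) , ≋⇒≈X (s≋s′ 1F) , ≋⇒≈X (s≋s′ 2F)
    where
    s≋s′ : ∀ k → s k ≋ s′ k
    s≋s′ k = ≋-trans (≋-sym (⟦sₛ⟧ k)) (≋-trans (≐⇒≋ (s-explicit k)) (⟦s′ₛ⟧ k))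

  Y-generator H-generator : X → Set ℓ
  Y-generator z = (z ≈X ⌜ h₁ ⌝) ⊎ (z ≈X ⌜ h₂ ⌝) ⊎ (z ≈X g)
  H-generator z = (z ≈X ⌜ h₁ ⌝) ⊎ (z ≈X ⌜ h₂ ⌝)

  yGen-generator : ∀ i → Y-generator ⟦ yGen i ⟧ₛ
  yGen-generator 0F = inj₁ (≋⇒≈X (≋-refl {⌜ h₁ ⌝}))
  yGen-generator 1F = inj₂ (inj₁ (≋⇒≈X (≋-refl {⌜ h₂ ⌝})))
  yGen-generator 2F = inj₂ (inj₂ (≋⇒≈X ⟦gₛ⟧))

  hGen-generator : ∀ i → H-generator ⟦ hGen i ⟧ₛ
  hGen-generator 0F = inj₁ (≋⇒≈X (≋-refl {⌜ h₁ ⌝}))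
  hGen-generator 1F = inj₂ (≋⇒≈X (≋-refl {⌜ h₂ ⌝}))

  tGen-generator : ∀ i → InT ⟦ tGen i ⟧ₛ
  tGen-generator 0F = inj₁ (≋⇒≈X (⟦tGen⟧ 0F))
  tGen-generator 1F = inj₂ (inj₁ (≋⇒≈X (⟦tGen⟧ 1F)))
  tGen-generator 2F = inj₂ (inj₂ (≋⇒≈X (⟦tGen⟧ 2F)))

  evalWord∈Y : ∀ w → InY ⟦ evalWord yGen w ⟧ₛ
  evalWord∈Y = ⟦evalWord⟧∈⟪⟫ yGen yGen-generator

  g∈Y : InY g
  g∈Y = gen (inj₂ (inj₂ (≋⇒≈X (≋-refl {g}))))

  h₁∈H : InH ⌜ h₁ ⌝
  h₁∈H = gen (hGen-generator 0F)

  h₂∈H : InH ⌜ h₂ ⌝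
  h₂∈H = gen (hGen-generator 1F)

  Y-induction : ∀ {p} {P : X → Set p} → IsSubgroupX P → (∀ i → P ⟦ yGen i ⟧ₛ) → ∀ {z} → InY z → P z
  Y-induction {P = P} P-subgroup P-yGen = Generated-⊆ P-subgroup generator∈P
    where
    open IsSubgroup P-subgroup
    generator∈P : ∀ {z} → Y-generator z → P z
    generator∈P {z} (inj₁ z≈h₁)        = resp-≈ (≋⇒≈X (≋-sym (≈X⇒≋ {z} {⌜ h₁ ⌝} z≈h₁))) (P-yGen 0F)
    generator∈P {z} (inj₂ (inj₁ z≈h₂)) = resp-≈ (≋⇒≈X (≋-sym (≈X⇒≋ {z} {⌜ h₂ ⌝} z≈h₂))) (P-yGen 1F)
    generator∈P {z} (inj₂ (inj₂ z≈g))  = resp-≈ (≋⇒≈X (≋-trans ⟦gₛ⟧ (≋-sym (≈X⇒≋ {z} {g} z≈g)))) (P-yGen 2F)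

  R : Fin 24 → X
  R a = ⟦ rep a ⟧ₛ

  R∈Y : ∀ a → InY (R a)
  R∈Y a = evalWord∈Y (lookup repWords a)

  SchreierIn : X → Fin 24 → Fin 24 → Set (c ⊔ ℓ)
  SchreierIn z a b = ⟪ InT ⟫ (R a · z · invX (R b))

  IsSchreierClosed : X → Set (c ⊔ ℓ)
  IsSchreierClosed z = InP (perm z) × (∀ a → SchreierIn z a (a ·ᵢ perm z))

  SchreierClosed-isSubgroup : IsSubgroupX IsSchreierClosed
  SchreierClosed-isSubgroup = record
    { resp-≈     = λ {z} {w} → resp-≈ {z} {w}
    ; has-one    = repPerm∈P 0F , one∈
    ; ∙-closed   = λ {z} {w} → ∙-closed {z} {w}
    ; inv-closed = λ {z} → inv-closed {z}
    }
    where
    resp-≈ : ∀ {z w} → z ≈X w → IsSchreierClosed z → IsSchreierClosed w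
    resp-≈ {z} {w} z≈w (z∈P , z-closed) = InP-resp {perm z} {perm w} z≈ₚw z∈P , λ a →
      ≡.subst (SchreierIn w a) (·ᵢ-cong a {perm z} {perm w} z≈ₚw)
        (resp (≋⇒≈X (·-cong (·-cong (≋-refl {R a}) z≋w) (≋-refl {invX (R (a ·ᵢ perm z))}))) (z-closed a))
      where
      z≋w : z ≋ w
      z≋w = ≈X⇒≋ z≈w
      z≈ₚw : perm z ≈ₚ perm w
      z≈ₚw = perm-cong z≋w

    one∈ : ∀ a → SchreierIn 1X a (a ·ᵢ Perm.id)
    one∈ a = ≡.subst (SchreierIn 1X a) (≡.sym (·ᵢ-id a)) (resp (≋⇒≈X (≋-sym (xε∙x⁻¹≈ε (R a)))) one)

    ∙-closed : ∀ {z w} → IsSchreierClosed z → IsSchreierClosed w → IsSchreierClosed (z · w)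
    ∙-closed {z} {w} (z∈P , z-closed) (w∈P , w-closed) = InP-∘ₚ {perm z} {perm w} z∈P w∈P , λ a →
      ≡.subst (SchreierIn (z · w) a) (·ᵢ-∘ₚ a {perm z} (perm w) z∈P)
        (resp (≋⇒≈X ([xy∙z⁻¹][zu∙v⁻¹]≈x[yu]∙v⁻¹ (R a) z (R (a ·ᵢ perm z)) w (R (a ·ᵢ perm z ·ᵢ perm w))))
              (mul (z-closed a) (w-closed (a ·ᵢ perm z))))

    inv-closed : ∀ {z} → IsSchreierClosed z → IsSchreierClosed (invX z)
    inv-closed {z} (z∈P , z-closed) = InP-flip {perm z} z∈P , λ a →
      resp (≋⇒≈X ([xy∙z⁻¹]⁻¹≈zy⁻¹∙x⁻¹ (R (a ·ᵢ Perm.flip (perm z))) z (R a)))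
        (invc (≡.subst (SchreierIn z (a ·ᵢ Perm.flip (perm z))) (·ᵢ-flip-· a {perm z} z∈P)
                       (z-closed (a ·ᵢ Perm.flip (perm z)))))

  yGen-SchreierClosed : ∀ i → IsSchreierClosed ⟦ yGen i ⟧ₛ
  yGen-SchreierClosed i = yGen∈P i , λ a →
    resp (≋⇒≈X (≋-sym (≐⇒≋ (schreierGenerator-word a i)))) (⟦evalWord⟧∈⟪⟫ tGen tGen-generator (schreierWord a i))

  Y⊆SchreierClosed : ∀ {z} → InY z → IsSchreierClosed z
  Y⊆SchreierClosed = Y-induction SchreierClosed-isSubgroup yGen-SchreierClosed

  perm∈P : ∀ {z} → InY z → InP (perm z)
  perm∈P z∈Y = proj₁ (Y⊆SchreierClosed z∈Y)

  N⊆⟨T⟩ : ∀ {z} → InN z → ⟪ InT ⟫ z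
  N⊆⟨T⟩ {z} (z∈Y , z≈1) = resp (≋⇒≈X (εx∙ε⁻¹≈x z))
    (≡.subst (SchreierIn z 0F) 0·ᵢz≡0 (proj₂ (Y⊆SchreierClosed z∈Y) 0F))
    where
    0·ᵢz≡0 : 0F ·ᵢ perm z ≡ 0F
    0·ᵢz≡0 = ≡.trans (·ᵢ-cong 0F {perm z} {Perm.id} (mk≈ₚ z≈1)) (·ᵢ-id 0F)

  N-isSubgroup : IsSubgroupX InN
  N-isSubgroup = record
    { resp-≈     = λ {z} {w} → resp-≈ {z} {w}
    ; has-one    = one , λ _ → ≡.refl
    ; ∙-closed   = λ {z} {w} → ∙-closed {z} {w}
    ; inv-closed = λ {z} → inv-closed {z}
    }
    where
    resp-≈ : ∀ {z w} → z ≈X w → InN z → InN w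
    resp-≈ {z} {w} z≈w (z∈Y , z≈1) =
      resp {u = z} {v = w} z≈w z∈Y ,
      ≈ₚ⇒≈ (S₆.trans {perm w} {perm z} {Perm.id} (S₆.sym (perm-cong (≈X⇒≋ {z} {w} z≈w))) (mk≈ₚ z≈1))

    ∙-closed : ∀ {z w} → InN z → InN w → InN (z · w)
    ∙-closed {z} {w} (z∈Y , z≈1) (w∈Y , w≈1) =
      mul z∈Y w∈Y , ≈ₚ⇒≈ (S₆.∙-cong {perm z} {Perm.id} {perm w} {Perm.id} (mk≈ₚ z≈1) (mk≈ₚ w≈1))

    inv-closed : ∀ {z} → InN z → InN (invX z)
    inv-closed {z} (z∈Y , z≈1) = invc z∈Y , ≈ₚ⇒≈ (S₆.⁻¹-cong {perm z} {Perm.id} (mk≈ₚ z≈1))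

  ⟨T⟩⊆N : ∀ {z} → ⟪ InT ⟫ z → InN z
  ⟨T⟩⊆N = Generated-⊆ N-isSubgroup t∈N
    where
    open IsSubgroup N-isSubgroup using () renaming (resp-≈ to N-resp)
    tGen-pure : ∀ i → shape (tGen i) Perm.≈ Perm.id
    tGen-pure 0F _ = ≡.refl
    tGen-pure 1F _ = ≡.refl
    tGen-pure 2F _ = ≡.refl
    tGen∈N : ∀ i → InN ⟦ tGen i ⟧ₛ
    tGen∈N i = resp (≋⇒≈X (≋-sym (≐⇒≋ (tGen-tWord i)))) (evalWord∈Y (tWord i)) , tGen-pure i
    t∈N : ∀ {z} → InT z → InN z
    t∈N {z} (inj₁ z≈t₁)        = N-resp (≋⇒≈X (≋-trans (⟦tGen⟧ 0F) (≋-sym (≈X⇒≋ {z} {t₁} z≈t₁)))) (tGen∈N 0F)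
    t∈N {z} (inj₂ (inj₁ z≈t₂)) = N-resp (≋⇒≈X (≋-trans (⟦tGen⟧ 1F) (≋-sym (≈X⇒≋ {z} {t₂} z≈t₂)))) (tGen∈N 1F)
    t∈N {z} (inj₂ (inj₂ z≈t₃)) = N-resp (≋⇒≈X (≋-trans (⟦tGen⟧ 2F) (≋-sym (≈X⇒≋ {z} {t₃} z≈t₃)))) (tGen∈N 2F)

  IsHElement : X → Set ℓ
  IsHElement z = ∃ λ m → z ≋ ⌜ hPerm m ⌝

  HElement-isSubgroup : IsSubgroupX IsHElement
  HElement-isSubgroup = record
    { resp-≈     = λ {z} {w} z≈w (m , z≋m) → m , ≋-trans (≋-sym (≈X⇒≋ {z} {w} z≈w)) z≋m
    ; has-one    = 0F , ≋-refl {1X}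
    ; ∙-closed   = λ {z} {w} → ∙-closed {z} {w}
    ; inv-closed = λ {z} → inv-closed {z}
    }
    where
    ∙-closed : ∀ {z w} → IsHElement z → IsHElement w → IsHElement (z · w)
    ∙-closed {z} {w} (m , z≋m) (n , w≋n) =
      let (k , k≈mn) = hPerm-∘ₚ m n
      in k , ≋-trans (·-cong z≋m w≋n) (≋-trans (⌜⌝-∘ₚ (hPerm m) (hPerm n)) (⌜⌝-cong (S₆.sym k≈mn)))

    inv-closed : ∀ {z} → IsHElement z → IsHElement (invX z)
    inv-closed {z} (m , z≋m) =
      let (k , k≈m⁻¹) = hPerm-flip m
      in k , ≋-trans (invX-cong z≋m) (≋-trans (⌜⌝-flip (hPerm m)) (⌜⌝-cong (S₆.sym k≈m⁻¹)))

  H⊆HElement : ∀ {z} → InH z → IsHElement z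
  H⊆HElement = Generated-⊆ HElement-isSubgroup generator∈H
    where
    hGen-element : ∀ i {z} → z ≋ ⌜ shape (hGen i) ⌝ → IsHElement z
    hGen-element i z≋i = let (m , m≈i) = hGen-hPerm i in m , ≋-trans z≋i (⌜⌝-cong (S₆.sym m≈i))
    generator∈H : ∀ {z} → H-generator z → IsHElement z
    generator∈H {z} (inj₁ z≈h₁) = hGen-element 0F (≈X⇒≋ {z} {⌜ h₁ ⌝} z≈h₁)
    generator∈H {z} (inj₂ z≈h₂) = hGen-element 1F (≈X⇒≋ {z} {⌜ h₂ ⌝} z≈h₂)

  hPerm∈H : ∀ m → InH ⌜ hPerm m ⌝
  hPerm∈H m = resp (≋⇒≈X (≐⇒≋ (hElem-pure m))) (⟦evalWord⟧∈⟪⟫ hGen hGen-generator (lookup hWords m))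

  H⊆Y : ∀ {z} → InH z → InY z
  H⊆Y = Generated-⊆ Generated-isSubgroup λ where
    (inj₁ z≈h₁) → gen (inj₁ z≈h₁)
    (inj₂ z≈h₂) → gen (inj₂ (inj₁ z≈h₂))

  hFactor : X → Fin 6
  hFactor z = proj₁ (hPerm-transversal (index (perm z)))

  HgH-normalForm : ∀ {z} → InDoubleCoset InH g z → ∃₂ λ i j → z ≋ ⟦ ⌜ hPerm i ⌝ₛ ⊛ gₛ ⊛ ⌜ hPerm j ⌝ₛ ⟧ₛ
  HgH-normalForm {z} (α , β , α∈H , β∈H , z≈αgβ) =
    let (i , α≋i) = H⊆HElement α∈H
        (j , β≋j) = H⊆HElement β∈H
    in i , j , ≋-trans (≈X⇒≋ {z} {α · g · β} z≈αgβ) (·-cong (·-cong α≋i (≋-sym ⟦gₛ⟧)) β≋j)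

  s∈Y : ∀ k → InY (s k)
  s∈Y 0F = mul g∈Y (H⊆Y h₂∈H)
  s∈Y 1F = mul (mul (mul (H⊆Y h₂∈H) (H⊆Y h₁∈H)) g∈Y) (H⊆Y h₁∈H)
  s∈Y 2F = mul (mul (mul (H⊆Y h₂∈H) (invc (H⊆Y h₁∈H))) g∈Y) (invc (H⊆Y h₁∈H))

  s∈S : ∀ k {z} → z ≋ s k → InS z
  s∈S 0F z≋s = inj₁ (≋⇒≈X z≋s)
  s∈S 1F z≋s = inj₂ (inj₁ (≋⇒≈X z≋s))
  s∈S 2F z≋s = inj₂ (inj₂ (≋⇒≈X z≋s))

  S⊆HgH : ∀ {z} → InS z → InDoubleCoset InH g z
  S⊆HgH {z} (inj₁ z≈s₁) =
    1X , ⌜ h₂ ⌝ , one , h₂∈H ,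
    ≋⇒≈X (≋-trans (≈X⇒≋ {z} {s₁} z≈s₁) (·-cong (≋-sym (Group.identityˡ wreathGroup g)) (≋-refl {⌜ h₂ ⌝})))
  S⊆HgH (inj₂ (inj₁ z≈s₂)) = ⌜ h₂ ⌝ · ⌜ h₁ ⌝ , ⌜ h₁ ⌝ , mul h₂∈H h₁∈H , h₁∈H , z≈s₂
  S⊆HgH (inj₂ (inj₂ z≈s₃)) = ⌜ h₂ ⌝ · invX ⌜ h₁ ⌝ , invX ⌜ h₁ ⌝ , mul h₂∈H (invc h₁∈H) , invc h₁∈H , z≈s₃

  module PreimageOfKlein {C : X → Set (c ⊔ ℓ)} (K : IsPreimageOfKlein C) where
    open IsPreimageOfKlein K
    open IsSubgroup subgroup

    conjugate-square≈1 : ∀ {r} → C r → (j : Fin 24) → square (perm r ∘ₚ perm r ^ repPerm j) ≈ₚ Perm.id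
    conjugate-square≈1 {r} r∈C j =
      mk≈ₚ λ i → proj₂ (exponent2 (r · (invX (R j) · r · R j)) (∙-closed r∈C (normal (R j) r (R∈Y j) r∈C))) i

    C⇒fixesBlocks : ∀ {r} → C r → FixesBlocks (perm r)
    C⇒fixesBlocks {r} r∈C with fixesBlocks? (repPerm (index (perm r)))
    ... | yes a-fixes = FixesBlocks-resp (perm∈P (C⊆Y r r∈C)) a-fixes
    ... | no a-moves  = ⊥-elim (square≉1 (S₆.trans (S₆.sym (square-cong (∘ₚ-cong r≈a (^-congˡ ρ r≈a))))
                                                   (conjugate-square≈1 r∈C j)))
      where
      j : Fin 24
      j = proj₁ (movesBlock⇒square≉1 (index (perm r)) a-moves)
      ρ : S6
      ρ = repPerm j
      square≉1 : ¬ square (repPerm (index (perm r)) ∘ₚ repPerm (index (perm r)) ^ ρ) ≈ₚ Perm.id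
      square≉1 = proj₂ (movesBlock⇒square≉1 (index (perm r)) a-moves)
      r≈a : perm r ≈ₚ repPerm (index (perm r))
      r≈a = S₆.sym (perm∈P (C⊆Y r r∈C))

    index-fixesBlocks : ∀ {r} → C r → FixesBlocks (repPerm (index (perm r)))
    index-fixesBlocks {r} r∈C = FixesBlocks-resp (S₆.sym (perm∈P (C⊆Y r r∈C))) (C⇒fixesBlocks r∈C)

    index-nontrivial : ∀ {r} → C r → ¬ perm r ≈ₚ Perm.id → ¬ repPerm (index (perm r)) ≈ₚ Perm.id
    index-nontrivial {r} r∈C r≉1 a≈1 = r≉1 (S₆.trans (S₆.sym (perm∈P (C⊆Y r r∈C))) a≈1)

    -- reps 0F and reps 1F lie in distinct cosets of N, so not both permute trivially.
    C-nontrivial : ∃ λ r → C r × ¬ perm r ≈ₚ Perm.id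
    C-nontrivial with perm (reps 0F) ≈ₚ? Perm.id | perm (reps 1F) ≈ₚ? Perm.id
    ... | no r₀≉1  | _        = reps 0F , reps∈C 0F , r₀≉1
    ... | yes _    | no r₁≉1  = reps 1F , reps∈C 1F , r₁≉1
    ... | yes r₀≈1 | yes r₁≈1 = ⊥-elim (reps-dist 0F 1F (λ ()) (r₀r₁⁻¹∈Y , ≈ₚ⇒≈ r₀r₁⁻¹≈1))
      where
      r₀r₁⁻¹∈Y : InY (reps 0F · invX (reps 1F))
      r₀r₁⁻¹∈Y = mul (C⊆Y _ (reps∈C 0F)) (invc (C⊆Y _ (reps∈C 1F)))
      r₀r₁⁻¹≈1 : perm (reps 0F) ∘ₚ Perm.flip (perm (reps 1F)) ≈ₚ Perm.id
      r₀r₁⁻¹≈1 = S₆-props.x≈y⇒x∙y⁻¹≈ε {perm (reps 0F)} {perm (reps 1F)} (S₆.trans r₀≈1 (S₆.sym r₁≈1))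

    fixesBlocks-realised : ∀ b → FixesBlocks (repPerm b) → ∃ λ w → C w × perm w ≈ₚ repPerm b
    fixesBlocks-realised b b-fixes with repPerm b ≈ₚ? Perm.id | C-nontrivial
    ... | yes b≈1 | _             = 1X , has-one , S₆.sym b≈1
    ... | no b≉1  | r , r∈C , r≉1 =
      let (j , a^j≈b) = klein-conjugate (index (perm r)) b (index-fixesBlocks r∈C) (index-nontrivial r∈C r≉1)
                                        b-fixes b≉1
          ρ = repPerm j
      in invX (R j) · r · R j , normal (R j) r (R∈Y j) r∈C ,
         S₆.trans (S₆.assoc (Perm.flip ρ) (perm r) ρ)
                  (S₆.trans (^-congˡ ρ (S₆.sym (perm∈P (C⊆Y r r∈C)))) a^j≈b)

    fixesBlocks⇒C : ∀ {z} → InY z → FixesBlocks (perm z) → C z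
    fixesBlocks⇒C {z} z∈Y z-fixes =
      let (w , w∈C , w≈a) = fixesBlocks-realised (index (perm z)) (FixesBlocks-resp (S₆.sym (perm∈P z∈Y)) z-fixes)
          zw⁻¹≈1 = S₆-props.x≈y⇒x∙y⁻¹≈ε {perm z} {perm w} (S₆.trans (S₆.sym (perm∈P z∈Y)) (S₆.sym w≈a))
      in resp-≈ (≋⇒≈X (cancelʳ {a = invX w} {c = w} (Group.inverseˡ wreathGroup w) z))
                (∙-closed (N⊆C _ (mul z∈Y (invc (C⊆Y w w∈C)) , ≈ₚ⇒≈ zw⁻¹≈1)) w∈C)

    H∩C-trivial : ∀ {z} → InH z → C z → z ≋ 1X
    H∩C-trivial z∈H z∈C =
      let (m , z≋m) = H⊆HElement z∈H
      in ≋-trans z≋m (⌜⌝-cong (hPerm-fixesBlocks m (FixesBlocks-resp (perm-cong z≋m) (C⇒fixesBlocks z∈C))))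

    complement : IsComplement InY InH C
    complement = record
      { H-subgroup   = Generated-isSubgroup
      ; C-subgroup   = subgroup
      ; C⊆Y          = C⊆Y _
      ; H∩C-trivial  = H∩C-trivial
      ; H-factor     = λ {z} _ → ⌜ hPerm (hFactor z) ⌝
      ; H-factor∈H   = λ {z} _ → hPerm∈H (hFactor z)
      ; H-factor·z∈C = λ {z} z∈Y → fixesBlocks⇒C (mul (H⊆Y (hPerm∈H (hFactor z))) z∈Y)
          (FixesBlocks-resp (S₆.∙-congˡ {hPerm (hFactor z)} (perm∈P z∈Y))
                            (proj₂ (hPerm-transversal (index (perm z)))))
      }

    HgH∩C⊆S : ∀ {z} → C z → InDoubleCoset InH g z → InS z
    HgH∩C⊆S {z} z∈C z∈HgH =
      let (i , j , z≋ihj) = HgH-normalForm {z} z∈HgH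
          (k , ihj≐sₖ) = doubleCoset-fixesBlocks i j (FixesBlocks-resp (perm-cong z≋ihj) (C⇒fixesBlocks z∈C))
      in s∈S k (≋-trans z≋ihj (≋-trans (≐⇒≋ ihj≐sₖ) (⟦sₛ⟧ k)))

    s∈C : ∀ k → C (s k)
    s∈C k = fixesBlocks⇒C (s∈Y k) (FixesBlocks-resp (perm-cong (⟦sₛ⟧ k)) (s-fixesBlocks k))

    s∈C×Γ≅Cay : C s₁ × C s₂ × C s₃ × GraphIso Γ (CayGraph C InS)
    s∈C×Γ≅Cay = s∈C 0F , s∈C 1F , s∈C 2F ,
                cosGraph≅cayGraph complement g (λ {z} → S⊆HgH {z}) (λ {z} → HgH∩C⊆S {z})

hasOrder2⇒squaresToOne : ∀ {c ℓ} (T : Group c ℓ) {x} → GroupNotions.HasOrder T x 2 → SquaresToOne T x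
hasOrder2⇒squaresToOne T {x} (_ , x∙[x∙ε]≈ε , _) = trans (∙-congˡ (sym (identityʳ x))) x∙[x∙ε]≈ε
  where open Group T

lemma3p2 : ∀ {c ℓ} (T : Group c ℓ) →
    let open Group T
        open GroupNotions T
        open Wreath T
    in IsFinite → IsNonAbelian → IsSimple →
       ∀ (x y : Carrier) (p : ℕ) → HasOrder x 2 → Prime p → ¬ (2 ∣ p) → HasOrder y p →
       (∀ t → ⟨ (λ u → (u ≈ x) ⊎ (u ≈ y)) ⟩ t) →
       let open Construction x y
       in (s₁ ≈X s₁′ × s₂ ≈X s₂′ × s₃ ≈X s₃′)
          × (∀ (C : X → Set (c ⊔ ℓ)) → IsPreimageOfKlein C →
               C s₁ × C s₂ × C s₃ × GraphIso Γ (CayGraph C InS))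
          × (∀ z → InN z ⇔ ⟪ InT ⟫ z)
lemma3p2 T _ _ _ x y _ x-of-order-2 _ _ _ _ =
  explicit-forms , (λ _ K → PreimageOfKlein.s∈C×Γ≅Cay K) , λ _ → mk⇔ N⊆⟨T⟩ ⟨T⟩⊆N
  where open ConstructionProperties T x y (hasOrder2⇒squaresToOne T x-of-order-2)
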